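{- Let $G$ be a finite graph, $\mathcal L$ a non-trivial linear class of bonds of $G$, and $X\subseteq E(G)$. Then the rank of $X$ in the join matroid $J(G,\mathcal L)$ is (1) $|V(G)|-|\pi_X|-1$ when $\pi_X$ is cobalanced, and (2) $|V(G)|-|\pi_X|$ when $\pi_X$ is un-cobalanced, where $|\pi_X|$ is the number of parts of $\pi_X$.
   Context: Graphs are finite, loops and multiple edges allowed. A bond is a minimal nonempty edge cut; $\delta(X)$ is the set of links with exactly one endpoint in a vertex set $X$. A tribond is $\delta(X_1)\cup\delta(X_2)\cup\delta(X_3)$ for a partition $\{X_1,X_2,X_3\}$ of the vertex set of one connected component into nonempty sets with each $G[X_i]$ connected and an edge joining each pair. A linear class of bonds is a set $\mathcal L$ of bonds such that for each such tripartition the number of $i$ with $\delta(X_i)\in\mathcal L$ is never exactly two; it is trivial if it contains every bond; bonds in $\mathcal L$ are cobalanced. A modular pair of bonds $B_1,B_2$ is one for which $G-(B_1\cup B_2)$ has two more components than $G$; a dibond is the union of a modular pair that is not a tribond. For non-trivial $\mathcal L$, $J_0(G,\mathcal L)$ is the matroid on $E(G)\cup\{e_0\}$ whose cocircuits are the bonds in $\mathcal L$, the sets $B\cup\{e_0\}$ for bonds $B\notin\mathcal L$, and the tribonds and dibonds containing no bond of $\mathcal L$; $J(G,\mathcal L)=J_0(G,\mathcal L)/e_0$. For $X\subseteq E(G)$, $\pi_X$ is the partition of $V(G)$ into vertex sets of the components of $(V(G),X)$; $\mathrm{Ext}(\pi)$ is the set of edges of $G$ whose endpoints lie in different parts of $\pi$.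 A partition $\pi$ (each part inducing a connected subgraph) is cobalanced if every bond of $G$ contained in $\mathrm{Ext}(\pi)$ lies in $\mathcal L$, and un-cobalanced otherwise. -}

module Defs where

open import Data.Nat using (ℕ; zero; suc; _+_; _≤_)
open import Data.Bool using (Bool; true; false; _xor_)
open import Data.Fin using (Fin)
open import Data.Fin.Subset
  using (Subset; _∈_; _∉_; _⊆_; _∪_; _∩_; ∁; ⊥; ⊤; Nonempty; ∣_∣)
open import Data.Vec using (Vec; _∷_; lookup; tabulate)
open import Data.Product using (Σ; ∃; ∃-syntax; _×_; _,_; proj₁; proj₂)
open import Data.Sum using (_⊎_)
open import Relation.Nullary using (¬_)
open import Relation.Binary.PropositionalEquality using (_≡_; _≢_)
open import Relation.Binary.Construct.Closure.ReflexiveTransitive using (Star)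

-- Finite graphs with loops and multiple edges:
-- vertices Fin nV, edges Fin nE, each edge has an (unordered) pair of ends.

record Graph : Set where
  field
    nV   : ℕ
    nE   : ℕ
    ends : Fin nE → Fin nV × Fin nV

open Graph public

VSet : Graph → Set
VSet G = Subset (nV G)

ESet : Graph → Set
ESet G = Subset (nE G)

b2n : Bool → ℕ
b2n true  = 1
b2n false = 0

module _ (G : Graph) where

  Joins : Fin (nE G) → Fin (nV G) → Fin (nV G) → Set
  Joins e u v = (ends G e ≡ (u , v)) ⊎ (ends G e ≡ (v , u))

  δ : VSet G → ESet G
  δ X = tabulate λ e → lookup X (proj₁ (ends G e)) xor lookup X (proj₂ (ends G e))

  IsCut : ESet G → Set
  IsCut D = ∃[ X ] D ≡ δ X

  IsBond : ESet G → Set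
  IsBond D = Nonempty D × IsCut D
           × (∀ D′ → Nonempty D′ → IsCut D′ → D′ ⊆ D → D′ ≡ D)

  Adj : ESet G → Fin (nV G) → Fin (nV G) → Set
  Adj S u v = ∃[ e ] (e ∈ S × Joins e u v)

  AdjIn : VSet G → Fin (nV G) → Fin (nV G) → Set
  AdjIn X u v = u ∈ X × v ∈ X × ∃[ e ] Joins e u v

  InducesConnected : VSet G → Set
  InducesConnected X = Nonempty X
    × (∀ u v → u ∈ X → v ∈ X → Star (AdjIn X) u v)

  IsComponent : VSet G → Set
  IsComponent C = InducesConnected C × δ C ≡ ⊥

  EdgeBetween : VSet G → VSet G → Set
  EdgeBetween X Y = ∃[ e ] ∃[ u ] ∃[ v ] (u ∈ X × v ∈ Y × Joins e u v)

  IsTripartition : VSet G → VSet G → VSet G → Set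
  IsTripartition X₁ X₂ X₃ =
      (∃[ C ] (IsComponent C × (X₁ ∪ (X₂ ∪ X₃)) ≡ C))
    × (X₁ ∩ X₂ ≡ ⊥) × (X₁ ∩ X₃ ≡ ⊥) × (X₂ ∩ X₃ ≡ ⊥)
    × InducesConnected X₁ × InducesConnected X₂ × InducesConnected X₃
    × EdgeBetween X₁ X₂ × EdgeBetween X₁ X₃ × EdgeBetween X₂ X₃

  IsTribond : ESet G → Set
  IsTribond T = ∃[ X₁ ] ∃[ X₂ ] ∃[ X₃ ]
    (IsTripartition X₁ X₂ X₃ × T ≡ (δ X₁ ∪ (δ X₂ ∪ δ X₃)))

  -- the partition π_S of V(G) into components of (V(G),S) has exactly k parts:
  -- the parts are in bijection with Fin k
  NumComponents : ESet G → ℕ → Set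
  NumComponents S k = Σ (Fin (nV G) → Fin k) λ f →
      (∀ i → ∃[ u ] f u ≡ i)
    × (∀ u v → (f u ≡ f v → Star (Adj S) u v) × (Star (Adj S) u v → f u ≡ f v))

  IsModularPair : ESet G → ESet G → Set
  IsModularPair B₁ B₂ = IsBond B₁ × IsBond B₂
    × ∃[ k ] (NumComponents ⊤ k × NumComponents (∁ (B₁ ∪ B₂)) (2 + k))

  IsDibond : ESet G → Set
  IsDibond D = ∃[ B₁ ] ∃[ B₂ ] (IsModularPair B₁ B₂ × D ≡ (B₁ ∪ B₂) × ¬ IsTribond D)

  module _ (L : ESet G → Bool) where

    IsLinearClass : Set
    IsLinearClass = (∀ B → L B ≡ true → IsBond B)
      × (∀ X₁ X₂ X₃ → IsTripartition X₁ X₂ X₃ →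
           b2n (L (δ X₁)) + (b2n (L (δ X₂)) + b2n (L (δ X₃))) ≢ 2)

    NonTrivial : Set
    NonTrivial = ∃[ B ] (IsBond B × L B ≡ false)

    ContainsNoLBond : ESet G → Set
    ContainsNoLBond T = ∀ B → IsBond B → L B ≡ true → ¬ (B ⊆ T)

    -- Cocircuits of J₀(G,L) on ground set Fin (1 + nE G); element zero is e₀,
    -- edge e of G is suc e, so  b ∷ S  is S together with e₀ iff b = true.
    IsCocircuitJ₀ : Subset (suc (nE G)) → Set
    IsCocircuitJ₀ D =
        (∃[ B ] (IsBond B × L B ≡ true  × D ≡ (false ∷ B)))
      ⊎ (∃[ B ] (IsBond B × L B ≡ false × D ≡ (true ∷ B)))
      ⊎ (∃[ T ] ((IsTribond T ⊎ IsDibond T) × ContainsNoLBond T × D ≡ (false ∷ T)))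

    InExt : ESet G → Fin (nE G) → Set
    InExt X e = ¬ Star (Adj X) (proj₁ (ends G e)) (proj₂ (ends G e))

    Cobalanced : ESet G → Set
    Cobalanced X = ∀ B → IsBond B → (∀ e → e ∈ B → InExt X e) → L B ≡ true

-- A matroid on Fin N given by its family of cocircuits.

module _ {N : ℕ} (Cocirc : Subset N → Set) where

  Spanning : Subset N → Set
  Spanning S = ∀ D → Cocirc D → Nonempty (S ∩ D)

  IsBasis : Subset N → Set
  IsBasis B = Spanning B × (∀ S → S ⊆ B → Spanning S → S ≡ B)

  Independent : Subset N → Set
  Independent I = ∃[ B ] (IsBasis B × I ⊆ B)

  IsRank : Subset N → ℕ → Set
  IsRank X r = (∃[ I ] (I ⊆ X × Independent I × ∣ I ∣ ≡ r))
             × (∀ I → I ⊆ X → Independent I → ∣ I ∣ ≤ r)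

-- rank in the contraction M/e₀ (e₀ = zero):  r_{M/e₀}(X) = r_M(X ∪ e₀) - r_M(e₀)
open import Data.Nat using (_∸_)

IsRankContract : {N : ℕ} (Cocirc : Subset (suc N) → Set) → Subset N → ℕ → Set
IsRankContract Cocirc X r = ∃[ a ] ∃[ b ]
  (IsRank Cocirc (true ∷ X) a × IsRank Cocirc (true ∷ ⊥) b × r ≡ a ∸ b)

-- rank of X ⊆ E(G) in J(G,L) = J₀(G,L)/e₀
IsRankJ : (G : Graph) (L : ESet G → Bool) → ESet G → ℕ → Set
IsRankJ G L = IsRankContract (IsCocircuitJ₀ G L)

-- Let F be a spanning forest of (V, X), so |F| = |V| - k. The edges of an independent set of
-- J₀ form a forest: dropping an edge e from a basis must leave some cocircuit unmet, and
-- cocircuits are unions of cuts, so no path of the remaining edges joins the ends of e.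
-- Hence r₀(X + e₀) ∈ {|V| - k, |V| - k + 1}, according to whether e₀ can join F.
-- If π_X is un-cobalanced, a bond B₀ ∉ L inside Ext(π_X) misses F, and F + e₀ extends to a
-- basis of J₀ (basis-with-e₀). If π_X is cobalanced, a basis containing e₀ and a forest
-- I ⊆ X has a cocircuit B + e₀ meeting it only in e₀, and an edge of B joined within X lets
-- I grow inside the components of X, so |I| + 1 ≤ |V| - k. Finally r₀(e₀) = 1 because L
-- is non-trivial, and r_J(X) = r₀(X + e₀) - 1.
module Submission where

open import Defs
open import Data.Nat using (ℕ; zero; suc; _+_; _≤_; _<_; _∸_; s≤s)
import Data.Nat.Properties as NP
open import Data.Bool as B using (Bool; true; false; _xor_; not; _∧_; _∨_)
open import Data.Bool.Properties using (∧-zeroʳ; ∧-identityʳ; ∨-zeroʳ; ¬-not; xor-same; xor-comm; not-involutive)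
open import Data.Fin as F using (Fin; zero; suc)
open import Data.Fin.Properties as FP using (any?; all?; injective⇒≤)
open import Data.Fin.Subset using (Subset; _∈_; _⊆_; _∪_; _∩_; ∁; Nonempty; ∣_∣; _-_; ⁅_⁆) renaming (⊥ to ∅; ⊤ to full)
open import Data.Fin.Subset.Properties using (nonempty?; x∈p⇒∣p-x∣<∣p∣; Empty-unique; ∣⊥∣≡0; p─⊥≡p; x∈p∩q⁺; x∈p∩q⁻; ⊆-antisym; anySubset?; _∈?_; _⊆?_; p⊆q⇒∣p∣≤∣q∣; x∈⁅x⁆; x∈⁅y⁆⇒x≡y; ∪-identityʳ)
open import Data.Vec using (Vec; []; _∷_; lookup; tabulate)
open import Data.Vec.Properties using ([]=⇒lookup; lookup⇒[]=; lookup∘tabulate; tabulate∘lookup; tabulate-cong; lookup-zipWith; lookup-map; lookup-replicate; ∷-injective; ∷-injectiveʳ; ≡-dec)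
open import Data.List using (List; []; _∷_; filter; allFin)
open import Data.List.Relation.Unary.Any using (here; there)
open import Data.List.Membership.Propositional using () renaming (_∈_ to _∈L_)
open import Data.List.Membership.Propositional.Properties using (∈-filter⁺; ∈-filter⁻; ∈-allFin)
open import Data.Product using (Σ; ∃-syntax; _×_; _,_; proj₁; proj₂)
open import Data.Sum using (_⊎_; inj₁; inj₂)
open import Data.Empty renaming (⊥ to ⊥₀) using (⊥-elim)
open import Function using (_∘_)
open import Relation.Nullary using (¬_; Dec; yes; no; does)
open import Relation.Nullary.Decidable using (_⊎-dec_; _×-dec_; _→-dec_; ¬?; map′)
open import Relation.Binary.PropositionalEquality
open import Relation.Binary.Construct.Closure.ReflexiveTransitive using (Star; ε; _◅_; _◅◅_)
import Relation.Binary.Construct.Closure.ReflexiveTransitive as Star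

false≢true : false ≢ true
false≢true ()

true≢false : true ≢ false
true≢false ()

xor≡false⇒≡ : ∀ a b → a xor b ≡ false → a ≡ b
xor≡false⇒≡ false false _ = refl
xor≡false⇒≡ true true _ = refl
xor≡false⇒≡ false true ()
xor≡false⇒≡ true false ()

xor≡true⇒≢ : ∀ a b → a xor b ≡ true → a ≢ b
xor≡true⇒≢ false false ()
xor≡true⇒≢ true true ()
xor≡true⇒≢ false true _ ()
xor≡true⇒≢ true false _ ()

≢⇒xor≡true : ∀ a b → a ≢ b → a xor b ≡ true
≢⇒xor≡true a b a≢b = trans (cong (_xor b) (¬-not a≢b)) (not-xor≡true b)
  where
  not-xor≡true : ∀ b → not b xor b ≡ true
  not-xor≡true false = refl
  not-xor≡true true = refl

≡⇒xor≡false : ∀ a b → a ≡ b → a xor b ≡ false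
≡⇒xor≡false a .a refl = xor-same a

∨≡true⇒⊎ : ∀ a b → a ∨ b ≡ true → a ≡ true ⊎ b ≡ true
∨≡true⇒⊎ true b _ = inj₁ refl
∨≡true⇒⊎ false b e = inj₂ e

∧≡true⇒× : ∀ a b → a ∧ b ≡ true → a ≡ true × b ≡ true
∧≡true⇒× true true _ = refl , refl
∧≡true⇒× false b ()
∧≡true⇒× true false ()

-- Membership in a Subset, stated as a Boolean equation so that it can be
-- rewritten with and case-split on.
Mem : ∀ {n} → Subset n → Fin n → Set
Mem p x = lookup p x ≡ true

∈⇒Mem : ∀ {n} {x : Fin n} {p : Subset n} → x ∈ p → Mem p x
∈⇒Mem = []=⇒lookup

Mem⇒∈ : ∀ {n} {x : Fin n} {p : Subset n} → Mem p x → x ∈ p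
Mem⇒∈ {x = x} {p} = lookup⇒[]= x p

⊆⇒Mem : ∀ {n} {p q : Subset n} → p ⊆ q → ∀ i → Mem p i → Mem q i
⊆⇒Mem p⊆q i h = ∈⇒Mem (p⊆q (Mem⇒∈ h))

Mem⇒⊆ : ∀ {n} {p q : Subset n} → (∀ i → Mem p i → Mem q i) → p ⊆ q
Mem⇒⊆ h {i} m = Mem⇒∈ (h i (∈⇒Mem m))

lookup-ext : ∀ {a} {A : Set a} {n} (p q : Vec A n) → (∀ i → lookup p i ≡ lookup q i) → p ≡ q
lookup-ext p q h = trans (sym (tabulate∘lookup p)) (trans (tabulate-cong h) (tabulate∘lookup q))

Mem-antisym : ∀ {n} (p q : Subset n) → (∀ i → Mem p i → Mem q i) → (∀ i → Mem q i → Mem p i) → p ≡ q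
Mem-antisym p q p⊆q q⊆p = ⊆-antisym (Mem⇒⊆ p⊆q) (Mem⇒⊆ q⊆p)

lookup-cong : ∀ {n} {p q : Subset n} → p ≡ q → ∀ i → lookup p i ≡ lookup q i
lookup-cong refl i = refl

lookup-∪ : ∀ {n} (p q : Subset n) i → lookup (p ∪ q) i ≡ lookup p i ∨ lookup q i
lookup-∪ p q i = lookup-zipWith _∨_ i p q

lookup-∩ : ∀ {n} (p q : Subset n) i → lookup (p ∩ q) i ≡ lookup p i ∧ lookup q i
lookup-∩ p q i = lookup-zipWith _∧_ i p q

lookup-∁ : ∀ {n} (p : Subset n) i → lookup (∁ p) i ≡ not (lookup p i)
lookup-∁ p i = lookup-map i not p

lookup-∅ : ∀ {n} (i : Fin n) → lookup (∅ {n}) i ≡ false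
lookup-∅ i = lookup-replicate i false

lookup-⊤ : ∀ {n} (i : Fin n) → lookup (full {n}) i ≡ true
lookup-⊤ i = lookup-replicate i true

lookup-⁅y⁆ : ∀ {n} (y i : Fin n) → i ≢ y → lookup ⁅ y ⁆ i ≡ false
lookup-⁅y⁆ zero zero i≢y = ⊥-elim (i≢y refl)
lookup-⁅y⁆ zero (suc i) _ = lookup-∅ i
lookup-⁅y⁆ (suc y) zero _ = refl
lookup-⁅y⁆ (suc y) (suc i) i≢y = lookup-⁅y⁆ y i (λ e → i≢y (cong suc e))

lookup-p-x-x : ∀ {n} (p : Subset n) x → lookup (p - x) x ≡ false
lookup-p-x-x (b ∷ p) zero = refl
lookup-p-x-x (b ∷ p) (suc x) = lookup-p-x-x p x

lookup-p-x-y : ∀ {n} (p : Subset n) x i → i ≢ x → lookup (p - x) i ≡ lookup p i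
lookup-p-x-y (b ∷ p) zero zero i≢x = ⊥-elim (i≢x refl)
lookup-p-x-y (b ∷ p) zero (suc i) _ = cong (λ s → lookup s i) (p─⊥≡p p)
lookup-p-x-y (b ∷ p) (suc x) zero _ = refl
lookup-p-x-y (b ∷ p) (suc x) (suc i) i≢x = lookup-p-x-y p x i (λ e → i≢x (cong suc e))

Mem-∪⁻ : ∀ {n} (p q : Subset n) z → Mem (p ∪ q) z → Mem p z ⊎ Mem q z
Mem-∪⁻ p q z m = ∨≡true⇒⊎ _ _ (trans (sym (lookup-∪ p q z)) m)

Mem-∪ˡ : ∀ {n} (p q : Subset n) z → Mem p z → Mem (p ∪ q) z
Mem-∪ˡ p q z m rewrite lookup-∪ p q z | m = refl

Mem-∪ʳ : ∀ {n} (p q : Subset n) z → Mem q z → Mem (p ∪ q) z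
Mem-∪ʳ p q z m rewrite lookup-∪ p q z | m = ∨-zeroʳ (lookup p z)

Mem-⁅x⁆ : ∀ {n} (x : Fin n) → Mem ⁅ x ⁆ x
Mem-⁅x⁆ x = ∈⇒Mem (x∈⁅x⁆ x)

Mem-⁅y⁆ : ∀ {n} (y z : Fin n) → Mem ⁅ y ⁆ z → z ≡ y
Mem-⁅y⁆ y z m = x∈⁅y⁆⇒x≡y y (Mem⇒∈ m)

Mem-remove⇒≢ : ∀ {n} (p : Subset n) x z → Mem (p - x) z → z ≢ x
Mem-remove⇒≢ p x z m refl = false≢true (trans (sym (lookup-p-x-x p x)) m)

Mem-remove⁻ : ∀ {n} (p : Subset n) x z → Mem (p - x) z → Mem p z
Mem-remove⁻ p x z m = trans (sym (lookup-p-x-y p x z (Mem-remove⇒≢ p x z m))) m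

Mem-remove⁺ : ∀ {n} (p : Subset n) x z → z ≢ x → Mem p z → Mem (p - x) z
Mem-remove⁺ p x z z≢x m = trans (lookup-p-x-y p x z z≢x) m

Mem-remove-or : ∀ {n} (p : Subset n) x z → Mem p z → Mem (p - x) z ⊎ z ≡ x
Mem-remove-or p x z m with z F.≟ x
... | yes z≡x = inj₂ z≡x
... | no z≢x = inj₁ (Mem-remove⁺ p x z z≢x m)

Mem-remove-mono : ∀ {n} (p q : Subset n) x → (∀ z → Mem q z → Mem p z) → ∀ z → Mem (q - x) z → Mem (p - x) z
Mem-remove-mono p q x q⊆p z m =
  Mem-remove⁺ p x z (Mem-remove⇒≢ q x z m) (q⊆p z (Mem-remove⁻ q x z m))

∣p∣≡1+∣p-x∣ : ∀ {n} (p : Subset n) x → Mem p x → ∣ p ∣ ≡ suc ∣ p - x ∣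
∣p∣≡1+∣p-x∣ (true ∷ p) zero refl = cong suc (cong ∣_∣ (sym (p─⊥≡p p)))
∣p∣≡1+∣p-x∣ (true ∷ p) (suc x) h = cong suc (∣p∣≡1+∣p-x∣ p x h)
∣p∣≡1+∣p-x∣ (false ∷ p) (suc x) h = ∣p∣≡1+∣p-x∣ p x h

∣p∪⁅x⁆∣≡1+∣p∣ : ∀ {n} (p : Subset n) x → lookup p x ≡ false → ∣ p ∪ ⁅ x ⁆ ∣ ≡ suc ∣ p ∣
∣p∪⁅x⁆∣≡1+∣p∣ (false ∷ p) zero _ = cong suc (cong ∣_∣ (∪-identityʳ p))
∣p∪⁅x⁆∣≡1+∣p∣ (true ∷ p) zero ()
∣p∪⁅x⁆∣≡1+∣p∣ (true ∷ p) (suc x) h = cong suc (∣p∪⁅x⁆∣≡1+∣p∣ p x h)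
∣p∪⁅x⁆∣≡1+∣p∣ (false ∷ p) (suc x) h = ∣p∪⁅x⁆∣≡1+∣p∣ p x h

module _ {a ℓ} {A : Set a} {R : A → A → Set ℓ} where

  constant-along : ∀ {b} {B : Set b} (f : A → B) → (∀ {x y} → R x y → f x ≡ f y) →
                   ∀ {u v} → Star R u v → f u ≡ f v
  constant-along f h = Star.fold (λ x y → f x ≡ f y) (λ r → trans (h r)) refl

  restrict-to-closed : ∀ {p ℓ'} {R' : A → A → Set ℓ'} (P : A → Set p) →
                       (∀ {x y} → R x y → P x → P y) → (∀ {x y} → R x y → P x → R' x y) →
                       ∀ {u v} → Star R u v → P u → Star R' u v
  restrict-to-closed P closed step ε pu = ε
  restrict-to-closed P closed step (r ◅ p) pu = step r pu ◅ restrict-to-closed P closed step p (closed r pu)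

  label-changes-along : (f : A → Bool) → ∀ {u v} → Star R u v → f u ≢ f v →
                        ∃[ x ] ∃[ y ] (R x y × f x ≢ f y)
  label-changes-along f ε fu≢fv = ⊥-elim (fu≢fv refl)
  label-changes-along f {u} (_◅_ {j = w} r p) fu≢fv with f u B.≟ f w
  ... | no fu≢fw = u , w , r , fu≢fw
  ... | yes fu≡fw = label-changes-along f p (λ e → fu≢fv (trans fu≡fw e))

  module ThroughEdge {R' : A → A → Set ℓ} (a b : A)
    (step : ∀ {x y} → R x y → R' x y ⊎ ((x ≡ a × y ≡ b) ⊎ (x ≡ b × y ≡ a))) where

    Through : A → A → Set _
    Through u v = Star R' u v ⊎ ((Star R' u a × Star R' b v) ⊎ (Star R' u b × Star R' a v))

    split-at-edge : ∀ {u v} → Star R u v → Through u v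
    split-at-edge ε = inj₁ ε
    split-at-edge (r ◅ p) with step r | split-at-edge p
    ... | inj₁ r' | inj₁ q = inj₁ (r' ◅ q)
    ... | inj₁ r' | inj₂ (inj₁ (q1 , q2)) = inj₂ (inj₁ (r' ◅ q1 , q2))
    ... | inj₁ r' | inj₂ (inj₂ (q1 , q2)) = inj₂ (inj₂ (r' ◅ q1 , q2))
    ... | inj₂ (inj₁ (refl , refl)) | inj₁ q = inj₂ (inj₁ (ε , q))
    ... | inj₂ (inj₁ (refl , refl)) | inj₂ (inj₁ (q1 , q2)) = inj₂ (inj₁ (ε , q2))
    ... | inj₂ (inj₁ (refl , refl)) | inj₂ (inj₂ (q1 , q2)) = inj₁ q2
    ... | inj₂ (inj₂ (refl , refl)) | inj₁ q = inj₂ (inj₂ (ε , q))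
    ... | inj₂ (inj₂ (refl , refl)) | inj₂ (inj₁ (q1 , q2)) = inj₁ q2
    ... | inj₂ (inj₂ (refl , refl)) | inj₂ (inj₂ (q1 , q2)) = inj₂ (inj₂ (ε , q2))

surjective⇒≤ : ∀ {a b} (f : Fin a → Fin b) → (∀ i → ∃[ u ] f u ≡ i) → b ≤ a
surjective⇒≤ f onto = injective⇒≤ {f = λ i → proj₁ (onto i)}
  (λ {i} {j} e → trans (sym (proj₂ (onto i))) (trans (cong f e) (proj₂ (onto j))))

Labelling : ∀ n → (Fin n → Fin n → Set) → ℕ → Set
Labelling n R c = Σ (Fin n → Fin c) λ f → (∀ i → ∃[ u ] f u ≡ i) × (∀ u v → (f u ≡ f v → R u v) × (R u v → f u ≡ f v))

labelling-exists : ∀ n (R : Fin n → Fin n → Set) → (∀ u v → Dec (R u v)) → (∀ u → R u u) →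
                   (∀ {u v} → R u v → R v u) → (∀ {u v w} → R u v → R v w → R u w) → ∃[ c ] Labelling n R c
labelling-exists zero R R? rfl sym' trans' = zero , (λ ()) , (λ ()) , (λ ())
labelling-exists (suc n) R R? rfl sym' trans'
  with labelling-exists n (λ u v → R (suc u) (suc v)) (λ u v → R? (suc u) (suc v)) (λ u → rfl (suc u)) sym' trans'
... | c , f' , s' , k' with any? (λ j → R? zero (suc j))
... | yes (j , r) = c , f , s , k
  where
  f : Fin (suc n) → Fin c
  f zero = f' j
  f (suc i) = f' i
  s : ∀ i → ∃[ u ] f u ≡ i
  s i with s' i
  ... | u , e = suc u , e
  k : ∀ u v → (f u ≡ f v → R u v) × (R u v → f u ≡ f v)
  k zero zero = (λ _ → rfl zero) , (λ _ → refl)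
  k zero (suc i) = (λ e → trans' r (proj₁ (k' j i) e)) , (λ q → proj₂ (k' j i) (trans' (sym' r) q))
  k (suc i) zero = (λ e → sym' (trans' r (proj₁ (k' j i) (sym e)))) , (λ q → sym (proj₂ (k' j i) (trans' (sym' r) (sym' q))))
  k (suc i) (suc i') = k' i i'
... | no nr = suc c , f , s , k
  where
  f : Fin (suc n) → Fin (suc c)
  f zero = zero
  f (suc i) = suc (f' i)
  s : ∀ i → ∃[ u ] f u ≡ i
  s zero = zero , refl
  s (suc i) with s' i
  ... | u , e = suc u , cong suc e
  k : ∀ u v → (f u ≡ f v → R u v) × (R u v → f u ≡ f v)
  k zero zero = (λ _ → rfl zero) , (λ _ → refl)
  k zero (suc i) = (λ ()) , (λ q → ⊥-elim (nr (i , q)))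
  k (suc i) zero = (λ ()) , (λ q → ⊥-elim (nr (i , sym' q)))
  k (suc i) (suc i') = (λ e → proj₁ (k' i i') (FP.suc-injective e)) , (λ q → cong suc (proj₂ (k' i i') q))

module MatroidBases {N : ℕ} (Cocirc : Subset N → Set) where

  Witnessed : Subset N → Set
  Witnessed B = ∀ w → w ∈ B → ∃[ D ] (Cocirc D × (∀ w' → w' ∈ B → w' ∈ D → w' ≡ w))

  basis-by-witnesses : ∀ B → Spanning Cocirc B → Witnessed B → IsBasis Cocirc B
  basis-by-witnesses B sp wit = sp , minim
    where
    minim : ∀ S → S ⊆ B → Spanning Cocirc S → S ≡ B
    minim S sub spS = ⊆-antisym sub sup
      where
      sup : B ⊆ S
      sup {w} wB with wit w wB
      ... | D , isCoc , only with spS D isCoc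
      ... | w' , m with x∈p∩q⁻ S D m
      ... | w'S , w'D with only w' (sub w'S) w'D
      ... | refl = w'S


  basis-minus-not-spanning : ∀ B w → IsBasis Cocirc B → lookup B w ≡ true → ¬ Spanning Cocirc (B - w)
  basis-minus-not-spanning B w (_ , minim) h sp with minim (B - w) (Mem⇒⊆ (λ i m → Mem-remove⁻ B w i m)) sp
  ... | eq = false≢true (trans (sym (lookup-p-x-x B w)) (trans (cong (λ s → lookup s w) eq) h))


module Paths (G : Graph) where
  V = Fin (nV G)
  Ed = Fin (nE G)
  ES = Subset (nE G)
  VS = Subset (nV G)

  end₁ end₂ : Ed → V
  end₁ e = proj₁ (ends G e)
  end₂ e = proj₂ (ends G e)

  Conn : ES → V → V → Set
  Conn S = Star (Adj G S)


  joins-sym : ∀ {e u v} → Joins G e u v → Joins G e v u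
  joins-sym (inj₁ x) = inj₂ x
  joins-sym (inj₂ y) = inj₁ y

  adj-sym : ∀ {S u v} → Adj G S u v → Adj G S v u
  adj-sym (e , m , j) = e , m , joins-sym j

  conn-sym : ∀ {S u v} → Conn S u v → Conn S v u
  conn-sym = Star.reverse adj-sym

  joins⇒ends : ∀ {e u v} → Joins G e u v → (u ≡ end₁ e × v ≡ end₂ e) ⊎ (u ≡ end₂ e × v ≡ end₁ e)
  joins⇒ends {e} (inj₁ eq) = inj₁ (cong proj₁ (sym eq) , cong proj₂ (sym eq))
  joins⇒ends {e} (inj₂ eq) = inj₂ (cong proj₂ (sym eq) , cong proj₁ (sym eq))

  joins-own : ∀ e → Joins G e (end₁ e) (end₂ e)
  joins-own e = inj₁ refl

  edge⇒conn : ∀ {S} e → Mem S e → Conn S (end₁ e) (end₂ e)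
  edge⇒conn e m = (e , Mem⇒∈ m , joins-own e) ◅ ε

  lookup-δ : ∀ Z e → lookup (δ G Z) e ≡ lookup Z (end₁ e) xor lookup Z (end₂ e)
  lookup-δ Z e = lookup∘tabulate _ e

  lookup-δ-joins : ∀ Z {e u v} → Joins G e u v → lookup (δ G Z) e ≡ lookup Z u xor lookup Z v
  lookup-δ-joins Z {e} j with joins⇒ends j
  ... | inj₁ (refl , refl) = lookup-δ Z e
  ... | inj₂ (refl , refl) = trans (lookup-δ Z e) (xor-comm (lookup Z (end₁ e)) (lookup Z (end₂ e)))

  conn⇒same-side : ∀ S Z → (∀ e → Mem S e → lookup (δ G Z) e ≡ false) →
         ∀ {u v} → Conn S u v → lookup Z u ≡ lookup Z v
  conn⇒same-side S Z h = constant-along (lookup Z) (λ { (e , m , j) → xor≡false⇒≡ _ _ (trans (sym (lookup-δ-joins Z j)) (h e (∈⇒Mem m))) })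

  conn-crosses-δ : ∀ S Z {u v} → Conn S u v → lookup Z u ≢ lookup Z v →
          ∃[ e ] (Mem S e × lookup (δ G Z) e ≡ true)
  conn-crosses-δ S Z p ne with label-changes-along (lookup Z) p ne
  ... | x , y , (e , m , j) , d = e , ∈⇒Mem m , trans (lookup-δ-joins Z j) (≢⇒xor≡true _ _ d)

  conn-mono : ∀ {S S'} → (∀ e → Mem S e → Mem S' e) → ∀ {u v} → Conn S u v → Conn S' u v
  conn-mono h = Star.map (λ { (e , m , j) → e , Mem⇒∈ (h e (∈⇒Mem m)) , j })

  ConnVia : ES → V → V → V → V → Set
  ConnVia S a b u v = Conn S u v ⊎ ((Conn S u a × Conn S b v) ⊎ (Conn S u b × Conn S a v))

  conn-via : ∀ S S' e → (∀ z → Mem S z → Mem S' z ⊎ z ≡ e) →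
         ∀ {u v} → Conn S u v → ConnVia S' (end₁ e) (end₂ e) u v
  conn-via S S' e h = ThroughEdge.split-at-edge (end₁ e) (end₂ e) step
    where
    step : ∀ {x y} → Adj G S x y → Adj G S' x y ⊎ ((x ≡ end₁ e × y ≡ end₂ e) ⊎ (x ≡ end₂ e × y ≡ end₁ e))
    step (z , m , j) with h z (∈⇒Mem m)
    ... | inj₁ m' = inj₁ (z , Mem⇒∈ m' , j)
    ... | inj₂ refl = inj₂ (joins⇒ends j)

  conn-via-edge : ∀ {S} e → Mem S e → ∀ {u v} → ConnVia S (end₁ e) (end₂ e) u v → Conn S u v
  conn-via-edge e m (inj₁ p) = p
  conn-via-edge e m (inj₂ (inj₁ (p , q))) = p ◅◅ edge⇒conn e m ◅◅ q
  conn-via-edge e m (inj₂ (inj₂ (p , q))) = p ◅◅ conn-sym (edge⇒conn e m) ◅◅ q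

  conn-via-conn : ∀ {S a b} → Conn S a b → ∀ {u v} → ConnVia S a b u v → Conn S u v
  conn-via-conn c (inj₁ p) = p
  conn-via-conn c (inj₂ (inj₁ (p , q))) = p ◅◅ c ◅◅ q
  conn-via-conn c (inj₂ (inj₂ (p , q))) = p ◅◅ conn-sym c ◅◅ q

  conn-∅⇒≡ : ∀ S → ¬ Nonempty S → ∀ {u v} → Conn S u v → u ≡ v
  conn-∅⇒≡ S ne ε = refl
  conn-∅⇒≡ S ne ((e , m , j) ◅ p) = ⊥-elim (ne (e , m))

  δ≡true⇒≢ : ∀ Z e → lookup (δ G Z) e ≡ true → lookup Z (end₁ e) ≢ lookup Z (end₂ e)
  δ≡true⇒≢ Z e h = xor≡true⇒≢ _ _ (trans (sym (lookup-δ Z e)) h)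

  δ≡false⇒≡ : ∀ Z e → lookup (δ G Z) e ≡ false → lookup Z (end₁ e) ≡ lookup Z (end₂ e)
  δ≡false⇒≡ Z e h = xor≡false⇒≡ _ _ (trans (sym (lookup-δ Z e)) h)

  ≢⇒δ≡true : ∀ Z e → lookup Z (end₁ e) ≢ lookup Z (end₂ e) → lookup (δ G Z) e ≡ true
  ≢⇒δ≡true Z e ne = trans (lookup-δ Z e) (≢⇒xor≡true _ _ ne)

  ≡⇒δ≡false : ∀ Z e → lookup Z (end₁ e) ≡ lookup Z (end₂ e) → lookup (δ G Z) e ≡ false
  ≡⇒δ≡false Z e eq = trans (lookup-δ Z e) (≡⇒xor≡false _ _ eq)

  δ⊆δ : ∀ (W Z : VS) e → (∀ u v → Joins G e u v → lookup W u ≡ true → lookup W v ≡ false → lookup Z u ≢ lookup Z v) →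
           lookup (δ G W) e ≡ true → lookup (δ G Z) e ≡ true
  δ⊆δ W Z e h d with lookup W (end₁ e) in eq1 | lookup W (end₂ e) in eq2
  ... | true | false = ≢⇒δ≡true Z e (h _ _ (joins-own e) eq1 eq2)
  ... | false | true = ≢⇒δ≡true Z e (λ q → h _ _ (joins-sym (joins-own e)) eq2 eq1 (sym q))
  ... | true | true = ⊥-elim (δ≡true⇒≢ W e d (trans eq1 (sym eq2)))
  ... | false | false = ⊥-elim (δ≡true⇒≢ W e d (trans eq1 (sym eq2)))

  conn-joins : ∀ {S e u v} → Conn S (end₁ e) (end₂ e) → Joins G e u v → Conn S u v
  conn-joins c j with joins⇒ends j
  ... | inj₁ (refl , refl) = c
  ... | inj₂ (refl , refl) = conn-sym c

  path-in-induced : ∀ S (W : VS) → (∀ {y z} → Adj G S y z → lookup W y ≡ true → lookup W z ≡ true) →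
                ∀ {u v} → Conn S u v → lookup W u ≡ true → Star (AdjIn G W) u v
  path-in-induced S W cl = restrict-to-closed (λ y → lookup W y ≡ true) cl step
    where
    step : ∀ {y z} → Adj G S y z → lookup W y ≡ true → AdjIn G W y z
    step {y} {z} a hy = Mem⇒∈ hy , Mem⇒∈ (cl a hy) , proj₁ a , proj₂ (proj₂ a)

  conn?-fuel : ∀ k (S : ES) → ∣ S ∣ < k → ∀ u v → Dec (Conn S u v)
  conn?-fuel (suc k) S lt u v with nonempty? S
  ... | no ne = map′ (λ { refl → ε }) (conn-∅⇒≡ S ne) (u F.≟ v)
  ... | yes (e , m) =
        map′ (conn-via-edge e (∈⇒Mem m) ∘ conn-via-mono)
             (conn-via S (S - e) e (λ z mz → Mem-remove-or S e z mz))
             (D u v ⊎-dec ((D u (end₁ e) ×-dec D (end₂ e) v) ⊎-dec (D u (end₂ e) ×-dec D (end₁ e) v)))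
    where
    lt' : ∣ S - e ∣ < k
    lt' = NP.≤-trans (x∈p⇒∣p-x∣<∣p∣ m) (NP.≤-pred lt)
    D : ∀ u v → Dec (Conn (S - e) u v)
    D = conn?-fuel k (S - e) lt'
    cm : ∀ {x y} → Conn (S - e) x y → Conn S x y
    cm = conn-mono (Mem-remove⁻ S e)
    conn-via-mono : ∀ {u v} → ConnVia (S - e) (end₁ e) (end₂ e) u v → ConnVia S (end₁ e) (end₂ e) u v
    conn-via-mono (inj₁ p) = inj₁ (cm p)
    conn-via-mono (inj₂ (inj₁ (p , q))) = inj₂ (inj₁ (cm p , cm q))
    conn-via-mono (inj₂ (inj₂ (p , q))) = inj₂ (inj₂ (cm p , cm q))

  conn? : ∀ S u v → Dec (Conn S u v)
  conn? S = conn?-fuel (suc ∣ S ∣) S (NP.n<1+n _)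

  reach : ES → V → VS
  reach S u = tabulate (λ v → does (conn? S u v))

  reach⇒conn : ∀ S u v → lookup (reach S u) v ≡ true → Conn S u v
  reach⇒conn S u v h with conn? S u v | lookup∘tabulate (λ v → does (conn? S u v)) v
  ... | yes p | _ = p
  ... | no _ | eq = ⊥-elim (false≢true (trans (sym eq) h))

  conn⇒reach : ∀ S u v → Conn S u v → lookup (reach S u) v ≡ true
  conn⇒reach S u v c with conn? S u v | lookup∘tabulate (λ v → does (conn? S u v)) v
  ... | yes _ | eq = eq
  ... | no n | _ = ⊥-elim (n c)

  reach≡false⇒¬conn : ∀ S u v → lookup (reach S u) v ≡ false → ¬ Conn S u v
  reach≡false⇒¬conn S u v h c with trans (sym (conn⇒reach S u v c)) h
  ... | ()


module ComponentCounting (G : Graph) where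
  open Paths G

  Forest : ES → Set
  Forest F = ∀ e → Mem F e → ¬ Conn (F - e) (end₁ e) (end₂ e)

  forest-⊆ : ∀ S S' → Forest S → (∀ e → Mem S' e → Mem S e) → Forest S'
  forest-⊆ S S' fs h e m c = fs e (h e m) (conn-mono (Mem-remove-mono S S' e h) c)

  NC : ES → ℕ → Set
  NC = NumComponents G

  NC-cong : ∀ {S S' k} → (∀ u v → Conn S u v → Conn S' u v) → (∀ u v → Conn S' u v → Conn S u v) →
               NC S k → NC S' k
  NC-cong h1 h2 (f , s , k) = f , s , λ u v → (λ e → h1 u v (proj₁ (k u v) e)) , (λ c → proj₂ (k u v) (h2 u v c))

  NC-exists : ∀ S → ∃[ k ] NC S k
  NC-exists S = labelling-exists (nV G) (Conn S) (conn? S) (λ u → ε) conn-sym _◅◅_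

  NC-remove-bridge : ∀ S y c → Mem S y → ¬ Conn (S - y) (end₁ y) (end₂ y) → NC S c → NC (S - y) (suc c)
  NC-remove-bridge S y c my np (f , s , k) = h , sh , kh
    where
    S' = S - y
    A = reach S' (end₁ y)
    cm : ∀ {u v} → Conn S' u v → Conn S u v
    cm = conn-mono (Mem-remove⁻ S y)
    h : V → Fin (suc c)
    h u with lookup A u
    ... | true = zero
    ... | false = suc (f u)
    bA : lookup A (end₂ y) ≡ false
    bA with lookup A (end₂ y) in eq
    ... | true = ⊥-elim (np (reach⇒conn S' (end₁ y) (end₂ y) eq))
    ... | false = refl
    hb : h (end₂ y) ≡ suc (f (end₂ y))
    hb rewrite bA = refl
    sh : ∀ i → ∃[ u ] h u ≡ i
    sh zero = end₁ y , aA
      where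
      aA : h (end₁ y) ≡ zero
      aA rewrite conn⇒reach S' (end₁ y) (end₁ y) ε = refl
    sh (suc i) with s i
    ... | u , e with lookup A u in eq
    ... | false = u , helper
      where helper : h u ≡ suc i
            helper rewrite eq = cong suc e
    ... | true = end₂ y , trans hb (cong suc (trans (proj₂ (k _ _) (conn-sym (edge⇒conn y my) ◅◅ cm (reach⇒conn S' (end₁ y) u eq))) e))
    kh : ∀ u v → (h u ≡ h v → Conn S' u v) × (Conn S' u v → h u ≡ h v)
    kh u v with lookup A u in eu | lookup A v in ev
    ... | true | true = (λ _ → conn-sym (reach⇒conn S' _ u eu) ◅◅ reach⇒conn S' _ v ev) , (λ _ → refl)
    ... | true | false = (λ ()) , (λ c → ⊥-elim (reach≡false⇒¬conn S' _ v ev (reach⇒conn S' _ u eu ◅◅ c)))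
    ... | false | true = (λ ()) , (λ c → ⊥-elim (reach≡false⇒¬conn S' _ u eu (reach⇒conn S' _ v ev ◅◅ conn-sym c)))
    ... | false | false = to , (λ c → cong suc (proj₂ (k u v) (cm c)))
      where
      to : suc (f u) ≡ suc (f v) → Conn S' u v
      to e with conn-via S S' y (λ z mz → Mem-remove-or S y z mz) (proj₁ (k u v) (FP.suc-injective e))
      ... | inj₁ p = p
      ... | inj₂ (inj₁ (p , q)) = ⊥-elim (reach≡false⇒¬conn S' _ u eu (conn-sym p))
      ... | inj₂ (inj₂ (p , q)) = ⊥-elim (reach≡false⇒¬conn S' _ v ev q)

  NC-remove-cycle-edge : ∀ S y c → Mem S y → Conn (S - y) (end₁ y) (end₂ y) → NC S c → NC (S - y) c
  NC-remove-cycle-edge S y c my p = NC-cong (λ u v q → conn-via-conn p (conn-via S (S - y) y (λ z mz → Mem-remove-or S y z mz) q))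
                                 (λ u v → conn-mono (Mem-remove⁻ S y))

  NC-∅ : ∀ S c → ¬ Nonempty S → NC S c → (c ≡ nV G)
  NC-∅ S c ne (f , s , k) = NP.≤-antisym (surjective⇒≤ f s) (injective⇒≤ {f = f} (λ {i} {j} e → conn-∅⇒≡ S ne (proj₁ (k i j) e)))

  forest-count-fuel : ∀ fuel S c → ∣ S ∣ < fuel → NC S c → (nV G ≤ ∣ S ∣ + c) × (Forest S → ∣ S ∣ + c ≤ nV G)
  forest-count-fuel (suc fuel) S c lt nc with nonempty? S
  ... | no ne = base S c ne nc
    where
    base : ∀ S c → ¬ Nonempty S → NC S c → (nV G ≤ ∣ S ∣ + c) × (Forest S → ∣ S ∣ + c ≤ nV G)
    base S c ne nc = NP.≤-reflexive (sym eq) , (λ _ → NP.≤-reflexive eq)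
      where
      eq : ∣ S ∣ + c ≡ nV G
      eq = cong₂ _+_ (trans (cong ∣_∣ (Empty-unique ne)) (∣⊥∣≡0 (nE G))) (NC-∅ S c ne nc)
  ... | yes (y , m) with conn? (S - y) (end₁ y) (end₂ y)
  ... | yes p =
        NP.≤-trans (proj₁ IH) (NP.≤-trans (NP.+-monoˡ-≤ c (NP.n≤1+n _)) (NP.≤-reflexive (cong (_+ c) (sym eqc)))) ,
        (λ fs → ⊥-elim (fs y (∈⇒Mem m) p))
    where IH = forest-count-fuel fuel (S - y) c (NP.≤-trans (x∈p⇒∣p-x∣<∣p∣ m) (NP.≤-pred lt)) (NC-remove-cycle-edge S y c (∈⇒Mem m) p nc)
          eqc = ∣p∣≡1+∣p-x∣ S y (∈⇒Mem m)
  ... | no np =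
        NP.≤-trans (proj₁ IH) (NP.≤-reflexive eq2) ,
        (λ fs → NP.≤-trans (NP.≤-reflexive (sym eq2)) (proj₂ IH (forest-⊆ S (S - y) fs (Mem-remove⁻ S y))))
    where IH = forest-count-fuel fuel (S - y) (suc c) (NP.≤-trans (x∈p⇒∣p-x∣<∣p∣ m) (NP.≤-pred lt)) (NC-remove-bridge S y c (∈⇒Mem m) np nc)
          eqc = ∣p∣≡1+∣p-x∣ S y (∈⇒Mem m)
          eq2 : ∣ S - y ∣ + suc c ≡ ∣ S ∣ + c
          eq2 = trans (NP.+-suc _ c) (cong (_+ c) (sym eqc))

  forest-count : ∀ S c → NC S c → (nV G ≤ ∣ S ∣ + c) × (Forest S → ∣ S ∣ + c ≤ nV G)
  forest-count S c = forest-count-fuel (suc ∣ S ∣) S c (NP.n<1+n _)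

  NC-coarser : ∀ S S' c c' → NC S c → NC S' c' → (∀ u v → Conn S u v → Conn S' u v) → c' ≤ c
  NC-coarser S S' c c' (f , s , k) (f' , s' , k') h =
    injective⇒≤ {f = ψ} (λ {i} {j} e → trans (sym (proj₂ (s' i))) (trans (proj₂ (k' _ _) (h _ _ (proj₁ (k _ _) e))) (proj₂ (s' j))))
    where
    ψ : Fin c' → Fin c
    ψ i = f (proj₁ (s' i))


module Forests (G : Graph) where
  open Paths G
  open ComponentCounting G

  conn-lift : ∀ {S S'} → (∀ e → Mem S e → Conn S' (end₁ e) (end₂ e)) → ∀ {u v} → Conn S u v → Conn S' u v
  conn-lift h ε = ε
  conn-lift h ((e , m , j) ◅ p) with joins⇒ends j
  ... | inj₁ (refl , refl) = h e (∈⇒Mem m) ◅◅ conn-lift h p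
  ... | inj₂ (refl , refl) = conn-sym (h e (∈⇒Mem m)) ◅◅ conn-lift h p

  forest-within-bound : ∀ I X k → NC X k → Forest I → (∀ e → Mem I e → Conn X (end₁ e) (end₂ e)) →
                        ∣ I ∣ + k ≤ nV G
  forest-within-bound I X k ncX forestI I⊆X with NC-exists I
  ... | c , ncI = NP.≤-trans (NP.+-monoʳ-≤ ∣ I ∣ (NC-coarser I X c k ncI ncX (λ u v → conn-lift I⊆X)))
                             (proj₂ (forest-count I c ncI) forestI)

  forest-add : ∀ F e → Forest F → ¬ Conn F (end₁ e) (end₂ e) → Forest (F ∪ ⁅ e ⁆)
  forest-add F e fF nc z mz c with z F.≟ e
  ... | yes refl = nc (conn-mono sub c)
    where
    sub : ∀ w → Mem ((F ∪ ⁅ e ⁆) - e) w → Mem F w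
    sub w m with Mem-∪⁻ F ⁅ e ⁆ w (Mem-remove⁻ (F ∪ ⁅ e ⁆) e w m)
    ... | inj₁ m' = m'
    ... | inj₂ m' = ⊥-elim (Mem-remove⇒≢ (F ∪ ⁅ e ⁆) e w m (Mem-⁅y⁆ e w m'))
  ... | no ne with Mem-∪⁻ F ⁅ e ⁆ z mz
  ... | inj₂ m' = ⊥-elim (ne (Mem-⁅y⁆ e z m'))
  ... | inj₁ zF with conn-via ((F ∪ ⁅ e ⁆) - z) (F - z) e sp c
    where
    sp : ∀ w → Mem ((F ∪ ⁅ e ⁆) - z) w → Mem (F - z) w ⊎ w ≡ e
    sp w m with Mem-∪⁻ F ⁅ e ⁆ w (Mem-remove⁻ (F ∪ ⁅ e ⁆) z w m)
    ... | inj₁ m' = inj₁ (Mem-remove⁺ F z w (Mem-remove⇒≢ (F ∪ ⁅ e ⁆) z w m) m')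
    ... | inj₂ m' = inj₂ (Mem-⁅y⁆ e w m')
  ... | inj₁ p = fF z zF p
  ... | inj₂ (inj₁ (p , q)) = nc (cm (conn-sym p) ◅◅ edge⇒conn z zF ◅◅ cm (conn-sym q))
    where cm = conn-mono (Mem-remove⁻ F z)
  ... | inj₂ (inj₂ (p , q)) = nc (cm q ◅◅ conn-sym (edge⇒conn z zF) ◅◅ cm p)
    where cm = conn-mono (Mem-remove⁻ F z)

  forest-∅ : Forest ∅
  forest-∅ e m = ⊥-elim (false≢true (trans (sym (lookup-∅ e)) m))

  record GreedyForest (F0 : ES) (es : List Ed) : Set where
    field
      F : ES
      forest : Forest F
      sup : ∀ z → Mem F0 z → Mem F z
      sub : ∀ z → Mem F z → Mem F0 z ⊎ z ∈L es
      conn : ∀ e → e ∈L es → Conn F (end₁ e) (end₂ e)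

  greedy-forest : ∀ F0 → Forest F0 → ∀ es → GreedyForest F0 es
  greedy-forest F0 f0 [] = record { F = F0 ; forest = f0 ; sup = λ z m → m ; sub = λ z m → inj₁ m ; conn = λ e () }
  greedy-forest F0 f0 (e ∷ es) with conn? F0 (end₁ e) (end₂ e)
  ... | yes c = record { F = F ; forest = forest ; sup = sup
                       ; sub = λ z m → sub' z m
                       ; conn = conn' }
    where
    open GreedyForest (greedy-forest F0 f0 es)
    sub' : ∀ z → Mem F z → Mem F0 z ⊎ z ∈L (e ∷ es)
    sub' z m with sub z m
    ... | inj₁ x = inj₁ x
    ... | inj₂ x = inj₂ (there x)
    conn' : ∀ e' → e' ∈L (e ∷ es) → Conn F (end₁ e') (end₂ e')
    conn' e' (here refl) = conn-mono sup c
    conn' e' (there x) = conn e' x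
  ... | no nc = record { F = F ; forest = forest ; sup = λ z m → sup z (Mem-∪ˡ F0 ⁅ e ⁆ z m)
                       ; sub = sub' ; conn = conn' }
    where
    open GreedyForest (greedy-forest (F0 ∪ ⁅ e ⁆) (forest-add F0 e f0 nc) es)
    sub' : ∀ z → Mem F z → Mem F0 z ⊎ z ∈L (e ∷ es)
    sub' z m with sub z m
    ... | inj₂ x = inj₂ (there x)
    ... | inj₁ x with Mem-∪⁻ F0 ⁅ e ⁆ z x
    ... | inj₁ y = inj₁ y
    ... | inj₂ y = inj₂ (here (Mem-⁅y⁆ e z y))
    conn' : ∀ e' → e' ∈L (e ∷ es) → Conn F (end₁ e') (end₂ e')
    conn' e' (here refl) = edge⇒conn e (sup e (Mem-∪ʳ F0 ⁅ e ⁆ e (Mem-⁅x⁆ e)))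
    conn' e' (there x) = conn e' x

  reach-constant : ∀ S w {u v} → Conn S u v → lookup (reach S w) u ≡ lookup (reach S w) v
  reach-constant S w {u} {v} c with lookup (reach S w) u in eu | lookup (reach S w) v in ev
  ... | true | true = refl
  ... | false | false = refl
  ... | true | false = ⊥-elim (reach≡false⇒¬conn S w v ev (reach⇒conn S w u eu ◅◅ c))
  ... | false | true = ⊥-elim (reach≡false⇒¬conn S w u eu (reach⇒conn S w v ev ◅◅ conn-sym c))

  δ-unique : ∀ S' x → (∀ e → ConnVia S' (end₁ x) (end₂ x) (end₁ e) (end₂ e)) →
              ∀ Z W → (∀ {u v} → Conn S' u v → lookup Z u ≡ lookup Z v) →
              (∀ {u v} → Conn S' u v → lookup W u ≡ lookup W v) →
              lookup (δ G Z) x ≡ true → lookup (δ G W) x ≡ true → δ G Z ≡ δ G W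
  δ-unique S' x th Z W sZ sW zx wx = lookup-ext _ _ pt
    where
    dz : lookup Z (end₁ x) ≢ lookup Z (end₂ x)
    dz = xor≡true⇒≢ _ _ (trans (sym (lookup-δ Z x)) zx)
    dw : lookup W (end₁ x) ≢ lookup W (end₂ x)
    dw = xor≡true⇒≢ _ _ (trans (sym (lookup-δ W x)) wx)
    pt : ∀ e → lookup (δ G Z) e ≡ lookup (δ G W) e
    pt e rewrite lookup-δ Z e | lookup-δ W e with th e
    ... | inj₁ p rewrite sZ p | sW p = trans (≡⇒xor≡false (lookup Z (end₂ e)) _ refl) (sym (≡⇒xor≡false (lookup W (end₂ e)) _ refl))
    ... | inj₂ (inj₁ (p , q)) rewrite sZ p | sW p | sym (sZ q) | sym (sW q) =
          trans (≢⇒xor≡true _ _ dz) (sym (≢⇒xor≡true _ _ dw))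
    ... | inj₂ (inj₂ (p , q)) rewrite sZ p | sW p | sym (sZ q) | sym (sW q) =
          trans (≢⇒xor≡true _ _ (λ e → dz (sym e))) (sym (≢⇒xor≡true _ _ (λ e → dw (sym e))))

  δ-meets-spanning : ∀ T → (∀ e → Conn T (end₁ e) (end₂ e)) → ∀ Z e → lookup (δ G Z) e ≡ true →
             ∃[ y ] (Mem T y × lookup (δ G Z) y ≡ true)
  δ-meets-spanning T mx Z e h = conn-crosses-δ T Z (mx e) (xor≡true⇒≢ _ _ (trans (sym (lookup-δ Z e)) h))


module FundamentalCuts (G : Graph) where
  open Paths G
  open ComponentCounting G
  open Forests G

  Ends : Ed → V → V → Set
  Ends x c d = (c ≡ end₁ x × d ≡ end₂ x) ⊎ (c ≡ end₂ x × d ≡ end₁ x)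

  ends⇒joins : ∀ {x c d} → Ends x c d → Joins G x c d
  ends⇒joins (inj₁ (refl , refl)) = inj₁ refl
  ends⇒joins (inj₂ (refl , refl)) = inj₂ refl

  lookup-δ-ends : ∀ Z {x c d} → Ends x c d → lookup (δ G Z) x ≡ lookup Z c xor lookup Z d
  lookup-δ-ends Z en = lookup-δ-joins Z (ends⇒joins en)

  module MaximalForest (T : ES) (fT : Forest T) (mx : ∀ e → Conn T (end₁ e) (end₂ e)) where

    ends⇒conn : ∀ {S x c d} → Mem S x → Ends x c d → Conn S c d
    ends⇒conn m en = (_ , Mem⇒∈ m , ends⇒joins en) ◅ ε

    ends-disconnected : ∀ {x c d} → Mem T x → Ends x c d → ¬ Conn (T - x) c d
    ends-disconnected m (inj₁ (refl , refl)) = fT _ m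
    ends-disconnected m (inj₂ (refl , refl)) c = fT _ m (conn-sym c)

    module Side (x : Ed) (xT : Mem T x) (c d : V) (en : Ends x c d) where
      Ax : VS
      Ax = reach (T - x) c

      side-constant : ∀ {u v} → Conn (T - x) u v → lookup Ax u ≡ lookup Ax v
      side-constant = reach-constant (T - x) c

      side-∋c : lookup Ax c ≡ true
      side-∋c = conn⇒reach (T - x) c c ε

      side-∌d : lookup Ax d ≡ false
      side-∌d with lookup Ax d in eq
      ... | true = ⊥-elim (ends-disconnected xT en (reach⇒conn (T - x) c d eq))
      ... | false = refl

      δ-side-∋x : lookup (δ G Ax) x ≡ true
      δ-side-∋x rewrite lookup-δ-ends Ax en | side-∋c | side-∌d = refl

      side-separates-x : lookup Ax (end₁ x) ≢ lookup Ax (end₂ x)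
      side-separates-x = xor≡true⇒≢ _ _ (trans (sym (lookup-δ Ax x)) δ-side-∋x)

      δ-side-∌ : ∀ y → Mem T y → y ≢ x → lookup (δ G Ax) y ≡ false
      δ-side-∌ y m ne rewrite lookup-δ Ax y = ≡⇒xor≡false _ _ (side-constant (edge⇒conn y (Mem-remove⁺ T x y ne m)))

      conn-via-x : ∀ e → ConnVia (T - x) (end₁ x) (end₂ x) (end₁ e) (end₂ e)
      conn-via-x e = conn-via T (T - x) x (λ z mz → Mem-remove-or T x z mz) (mx e)

      δ-side-unique : ∀ Z e → lookup (δ G Z) e ≡ true → (∀ y → Mem T y → lookup (δ G Z) y ≡ true → y ≡ x) →
                 δ G Z ≡ δ G Ax
      δ-side-unique Z e h only = δ-unique (T - x) x conn-via-x Z Ax stZ side-constant zx δ-side-∋x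
        where
        zx : lookup (δ G Z) x ≡ true
        zx with δ-meets-spanning T mx Z e h
        ... | y , yT , hy with only y yT hy
        ... | refl = hy
        stZ : ∀ {u v} → Conn (T - x) u v → lookup Z u ≡ lookup Z v
        stZ = conn⇒same-side (T - x) Z λ y m → lem y m
          where
          lem : ∀ y → Mem (T - x) y → lookup (δ G Z) y ≡ false
          lem y m with lookup (δ G Z) y in eq
          ... | false = refl
          ... | true = ⊥-elim (Mem-remove⇒≢ T x y m (only y (Mem-remove⁻ T x y m) eq))

      δ-side-∩T : ∀ y → Mem T y → lookup (δ G Ax) y ≡ true → y ≡ x
      δ-side-∩T y m h with y F.≟ x
      ... | yes e = e
      ... | no ne = ⊥-elim (false≢true (trans (sym (δ-side-∌ y m ne)) h))

      δ-side-bond : IsBond G (δ G Ax)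
      δ-side-bond = (x , Mem⇒∈ δ-side-∋x) , (Ax , refl) , minim
        where
        minim : ∀ D′ → Nonempty D′ → IsCut G D′ → D′ ⊆ δ G Ax → D′ ≡ δ G Ax
        minim D′ (e , m) (Z , refl) sub =
          δ-side-unique Z e (∈⇒Mem m) (λ y yT hy → δ-side-∩T y yT (∈⇒Mem (sub (Mem⇒∈ hy))))

    side-avoiding : ∀ x → Mem T x → ∀ w → ∃[ c ] ∃[ d ] (Ends x c d × lookup (reach (T - x) c) w ≡ false)
    side-avoiding x xT w with lookup (reach (T - x) (end₁ x)) w in eq
    ... | false = end₁ x , end₂ x , inj₁ (refl , refl) , eq
    ... | true with lookup (reach (T - x) (end₂ x)) w in eq2
    ... | false = end₂ x , end₁ x , inj₂ (refl , refl) , eq2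
    ... | true = ⊥-elim (fT x xT (reach⇒conn (T - x) (end₁ x) w eq ◅◅ conn-sym (reach⇒conn (T - x) (end₂ x) w eq2)))


module TwoForestEdges (G : Graph) where
  open Paths G
  open ComponentCounting G
  open Forests G
  open FundamentalCuts G

  -- For edges x ≠ f of a maximal forest T, let Ax be the component of T - x at the end
  -- of x away from f, and Af that of T - f away from x. The bonds inside
  -- D = δ Ax ∪ δ Af are δ Ax, δ Af and, when an edge g joins Ax to Af, the cut of the
  -- rest P of the component; so D is a tribond if such a g exists and a dibond otherwise.
  module TwoEdges (T : ES) (fT : Forest T) (mx : ∀ e → Conn T (end₁ e) (end₂ e))
            (x f : Ed) (xT : Mem T x) (fTT : Mem T f) (x≢f : x ≢ f)
            (cx dx cf df : V) (enx : Ends x cx dx) (enf : Ends f cf df)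
            (fa : lookup (reach (T - x) cx) (end₁ f) ≡ false)
            (xa : lookup (reach (T - f) cf) (end₁ x) ≡ false) where
    open MaximalForest T fT mx
    module SX = Side x xT cx dx enx
    module SF = Side f fTT cf df enf
    Ax = SX.Ax
    Af = SF.Ax
    T' = (T - x) - f

    T'⊆T-x : ∀ z → Mem T' z → Mem (T - x) z
    T'⊆T-x z m = Mem-remove⁻ (T - x) f z m
    T'⊆T : ∀ z → Mem T' z → Mem T z
    T'⊆T z m = Mem-remove⁻ T x z (T'⊆T-x z m)
    T'⊆T-f : ∀ z → Mem T' z → Mem (T - f) z
    T'⊆T-f z m = Mem-remove⁺ T f z (Mem-remove⇒≢ (T - x) f z m) (T'⊆T z m)
    T'∌x : ∀ z → Mem T' z → z ≢ x
    T'∌x z m = Mem-remove⇒≢ T x z (T'⊆T-x z m)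
    T'∌f : ∀ z → Mem T' z → z ≢ f
    T'∌f z m = Mem-remove⇒≢ (T - x) f z m

    side-x-constant : ∀ {u v} → Conn T' u v → lookup Ax u ≡ lookup Ax v
    side-x-constant c = SX.side-constant (conn-mono T'⊆T-x c)
    side-f-constant : ∀ {u v} → Conn T' u v → lookup Af u ≡ lookup Af v
    side-f-constant c = SF.side-constant (conn-mono T'⊆T-f c)

    fbA : lookup Ax (end₂ f) ≡ false
    fbA = trans (sym (SX.side-constant (edge⇒conn f (Mem-remove⁺ T x f (λ e → x≢f (sym e)) fTT)))) fa
    xbA : lookup Af (end₂ x) ≡ false
    xbA = trans (sym (SF.side-constant (edge⇒conn x (Mem-remove⁺ T f x x≢f xT)))) xa
    endOut : ∀ (Z : VS) {e c d} → Ends e c d → lookup Z (end₁ e) ≡ false → lookup Z (end₂ e) ≡ false →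
             lookup Z c ≡ false × lookup Z d ≡ false
    endOut Z (inj₁ (refl , refl)) p q = p , q
    endOut Z (inj₂ (refl , refl)) p q = q , p
    cfA = proj₁ (endOut Ax enf fa fbA)
    dfA = proj₂ (endOut Ax enf fa fbA)
    cxF = proj₁ (endOut Af enx xa xbA)
    dxF = proj₂ (endOut Af enx xa xbA)

    inAx : ∀ u → lookup Ax u ≡ true → Conn T' cx u
    inAx u h = restrict-to-closed (λ y → lookup Ax y ≡ true) cl st' (reach⇒conn (T - x) cx u h) SX.side-∋c
      where
      cl : ∀ {y z} → Adj G (T - x) y z → lookup Ax y ≡ true → lookup Ax z ≡ true
      cl {y} {z} a hy = trans (sym (SX.side-constant (a ◅ ε))) hy
      st' : ∀ {y z} → Adj G (T - x) y z → lookup Ax y ≡ true → Adj G T' y z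
      st' {y} {z} (e , m , j) hy with e F.≟ f
      ... | no ne = e , Mem⇒∈ (Mem-remove⁺ (T - x) f e ne (∈⇒Mem m)) , j
      ... | yes refl with joins⇒ends j
      ... | inj₁ (refl , refl) = ⊥-elim (false≢true (trans (sym fa) hy))
      ... | inj₂ (refl , refl) = ⊥-elim (false≢true (trans (sym fbA) hy))

    inAf : ∀ u → lookup Af u ≡ true → Conn T' cf u
    inAf u h = conn-mono sw (restrict-to-closed (λ y → lookup Af y ≡ true) cl st' (reach⇒conn (T - f) cf u h) SF.side-∋c)
      where
      sw : ∀ z → Mem ((T - f) - x) z → Mem T' z
      sw z m = Mem-remove⁺ (T - x) f z (Mem-remove⇒≢ T f z (Mem-remove⁻ (T - f) x z m))
                 (Mem-remove⁺ T x z (Mem-remove⇒≢ (T - f) x z m) (Mem-remove⁻ T f z (Mem-remove⁻ (T - f) x z m)))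
      cl : ∀ {y z} → Adj G (T - f) y z → lookup Af y ≡ true → lookup Af z ≡ true
      cl {y} {z} a hy = trans (sym (SF.side-constant (a ◅ ε))) hy
      st' : ∀ {y z} → Adj G (T - f) y z → lookup Af y ≡ true → Adj G ((T - f) - x) y z
      st' {y} {z} (e , m , j) hy with e F.≟ x
      ... | no ne = e , Mem⇒∈ (Mem-remove⁺ (T - f) x e ne (∈⇒Mem m)) , j
      ... | yes refl with joins⇒ends j
      ... | inj₁ (refl , refl) = ⊥-elim (false≢true (trans (sym xa) hy))
      ... | inj₂ (refl , refl) = ⊥-elim (false≢true (trans (sym xbA) hy))

    sides-disjoint : ∀ u → lookup Ax u ≡ true → lookup Af u ≡ false
    sides-disjoint u h = trans (sym (side-f-constant (inAx u h))) cxF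

    same-sides⇒conn : ∀ {u v} → Conn T u v → lookup Ax u ≡ lookup Ax v → lookup Af u ≡ lookup Af v → Conn T' u v
    same-sides⇒conn c ex ef with conn-via T (T - x) x (λ z mz → Mem-remove-or T x z mz) c
    ... | inj₂ (inj₁ (p , q)) = ⊥-elim (SX.side-separates-x (trans (sym (SX.side-constant p)) (trans ex (sym (SX.side-constant q)))))
    ... | inj₂ (inj₂ (p , q)) = ⊥-elim (SX.side-separates-x (trans (SX.side-constant q) (trans (sym ex) (SX.side-constant p))))
    ... | inj₁ c' with conn-via (T - x) T' f (λ z mz → Mem-remove-or (T - x) f z mz) c'
    ... | inj₁ c'' = c''
    ... | inj₂ (inj₁ (p , q)) = ⊥-elim (SF.side-separates-x (trans (sym (side-f-constant p)) (trans ef (sym (side-f-constant q)))))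
    ... | inj₂ (inj₂ (p , q)) = ⊥-elim (SF.side-separates-x (trans (side-f-constant q) (trans (sym ef) (side-f-constant p))))

    D : ES
    D = δ G Ax ∪ δ G Af

    T∩D : ∀ z → Mem T z → Mem D z → z ≡ x ⊎ z ≡ f
    T∩D z zT m with Mem-∪⁻ (δ G Ax) (δ G Af) z m
    ... | inj₁ h = inj₁ (SX.δ-side-∩T z zT h)
    ... | inj₂ h = inj₂ (SF.δ-side-∩T z zT h)

    Sub : VS → Set
    Sub Z = ∀ e → lookup (δ G Z) e ≡ true → Mem D e

    δ∩T⊆xf : ∀ Z → Sub Z → ∀ y → Mem T y → lookup (δ G Z) y ≡ true → y ≡ x ⊎ y ≡ f
    δ∩T⊆xf Z s y yT h = T∩D y yT (s y h)

    constant-on-T' : ∀ Z → Sub Z → ∀ {u v} → Conn T' u v → lookup Z u ≡ lookup Z v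
    constant-on-T' Z s = conn⇒same-side T' Z lem
      where
      lem : ∀ y → Mem T' y → lookup (δ G Z) y ≡ false
      lem y m with lookup (δ G Z) y in eq
      ... | false = refl
      ... | true with δ∩T⊆xf Z s y (T'⊆T y m) eq
      ... | inj₁ e = ⊥-elim (T'∌x y m e)
      ... | inj₂ e = ⊥-elim (T'∌f y m e)

    cxdxT : Conn T cx dx
    cxdxT = ends⇒conn xT enx
    cfdfT : Conn T cf df
    cfdfT = ends⇒conn fTT enf

    value-on-side-x : ∀ Z → Sub Z → ∀ u → lookup Ax u ≡ true → lookup Z u ≡ lookup Z cx
    value-on-side-x Z s u h = sym (constant-on-T' Z s (inAx u h))
    value-on-side-f : ∀ Z → Sub Z → ∀ u → lookup Af u ≡ true → lookup Z u ≡ lookup Z cf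
    value-on-side-f Z s u h = sym (constant-on-T' Z s (inAf u h))
    value-on-rest : ∀ Z → Sub Z → ∀ u → Conn T u cx → lookup Ax u ≡ false → lookup Af u ≡ false → lookup Z u ≡ lookup Z dx
    value-on-rest Z s u c h1 h2 = constant-on-T' Z s (same-sides⇒conn (c ◅◅ cxdxT) (trans h1 (sym SX.side-∌d)) (trans h2 (sym dxF)))

    δ∋x⇒separates : ∀ Z → lookup (δ G Z) x ≡ true → lookup Z cx ≢ lookup Z dx
    δ∋x⇒separates Z h = xor≡true⇒≢ _ _ (trans (sym (lookup-δ-ends Z enx)) h)
    δ∋f⇒separates : ∀ Z → lookup (δ G Z) f ≡ true → lookup Z cf ≢ lookup Z df
    δ∋f⇒separates Z h = xor≡true⇒≢ _ _ (trans (sym (lookup-δ-ends Z enf)) h)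

    cx-reaches-side : ∀ u → lookup Ax u ≡ true → Conn T cx u
    cx-reaches-side u h = conn-mono T'⊆T (inAx u h)
    cf-reaches-side : ∀ u → lookup Af u ≡ true → Conn T cf u
    cf-reaches-side u h = conn-mono T'⊆T (inAf u h)

    Unlinked : Set
    Unlinked = ∀ e u v → Joins G e u v → lookup Ax u ≡ true → lookup Af v ≡ true → ⊥₀

    δ-side⊆δ : Unlinked → ∀ Z → Sub Z → lookup (δ G Z) x ≡ true → ∀ e → lookup (δ G Ax) e ≡ true → lookup (δ G Z) e ≡ true
    δ-side⊆δ noaf Z s zx e = δ⊆δ Ax Z e h
      where
      h : ∀ u v → Joins G e u v → lookup Ax u ≡ true → lookup Ax v ≡ false → lookup Z u ≢ lookup Z v
      h u v j hu hv eq = δ∋x⇒separates Z zx (trans (sym (value-on-side-x Z s u hu)) (trans eq (value-on-rest Z s v cvx hv afv)))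
        where
        afv : lookup Af v ≡ false
        afv with lookup Af v in e2
        ... | false = refl
        ... | true = ⊥-elim (noaf e u v j hu e2)
        cvx : Conn T v cx
        cvx = conn-sym (cx-reaches-side u hu ◅◅ conn-joins (mx e) j)

    only-x⇒side-x : ∀ Z → Sub Z → ∀ e → lookup (δ G Z) e ≡ true → lookup (δ G Z) f ≡ false → δ G Z ≡ δ G Ax
    only-x⇒side-x Z s e h zf = SX.δ-side-unique Z e h only
      where
      only : ∀ y → Mem T y → lookup (δ G Z) y ≡ true → y ≡ x
      only y yT h' with δ∩T⊆xf Z s y yT h'
      ... | inj₁ q = q
      ... | inj₂ refl = ⊥-elim (false≢true (trans (sym zf) h'))

    only-f⇒side-f : ∀ Z → Sub Z → ∀ e → lookup (δ G Z) e ≡ true → lookup (δ G Z) x ≡ false → δ G Z ≡ δ G Af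
    only-f⇒side-f Z s e h zx = SF.δ-side-unique Z e h only
      where
      only : ∀ y → Mem T y → lookup (δ G Z) y ≡ true → y ≡ f
      only y yT h' with δ∩T⊆xf Z s y yT h'
      ... | inj₂ q = q
      ... | inj₁ refl = ⊥-elim (false≢true (trans (sym zx) h'))

    meets-x-or-f : ∀ Z → Sub Z → ∀ e → lookup (δ G Z) e ≡ true → lookup (δ G Z) x ≡ false → lookup (δ G Z) f ≡ false → ⊥₀
    meets-x-or-f Z s e h zx zf with δ-meets-spanning T mx Z e h
    ... | y , yT , h' with δ∩T⊆xf Z s y yT h'
    ... | inj₁ refl = false≢true (trans (sym zx) h')
    ... | inj₂ refl = false≢true (trans (sym zf) h')

    module LinkedSides (g : Ed) (u0 v0 : V) (jg : Joins G g u0 v0)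
                    (u0A : lookup Ax u0 ≡ true) (v0F : lookup Af v0 ≡ true) where
      C : VS
      C = reach T cx

      Cst : ∀ {u v} → Conn T u v → lookup C u ≡ lookup C v
      Cst = reach-constant T cx

      AxC : ∀ u → lookup Ax u ≡ true → lookup C u ≡ true
      AxC u h = conn⇒reach T cx u (cx-reaches-side u h)

      cxcf : Conn T cx cf
      cxcf = cx-reaches-side u0 u0A ◅◅ conn-joins (mx g) jg ◅◅ conn-sym (cf-reaches-side v0 v0F)

      AfC : ∀ u → lookup Af u ≡ true → lookup C u ≡ true
      AfC u h = conn⇒reach T cx u (cxcf ◅◅ cf-reaches-side u h)

      P : VS
      P = tabulate (λ u → lookup C u ∧ (not (lookup Ax u) ∧ not (lookup Af u)))

      lkP : ∀ u → lookup P u ≡ lookup C u ∧ (not (lookup Ax u) ∧ not (lookup Af u))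
      lkP u = lookup∘tabulate _ u

      inP : ∀ u → lookup C u ≡ true → lookup Ax u ≡ false → lookup Af u ≡ false → lookup P u ≡ true
      inP u h1 h2 h3 rewrite lkP u | h1 | h2 | h3 = refl

      Pin : ∀ u → lookup P u ≡ true → lookup C u ≡ true × lookup Ax u ≡ false × lookup Af u ≡ false
      Pin u h rewrite lkP u with lookup C u | lookup Ax u | lookup Af u
      ... | true | false | false = refl , refl , refl
      ... | true | true | _ = ⊥-elim (false≢true h)
      ... | true | false | true = ⊥-elim (false≢true h)
      ... | false | _ | _ = ⊥-elim (false≢true h)

      notP : ∀ u → lookup P u ≡ false → lookup C u ≡ true → lookup Ax u ≡ true ⊎ lookup Af u ≡ true
      notP u h c with lookup Ax u in e1 | lookup Af u in e2
      ... | true | _ = inj₁ refl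
      ... | false | true = inj₂ refl
      ... | false | false = ⊥-elim (false≢true (trans (sym h) (inP u c e1 e2)))

      PAx : ∀ u → lookup Ax u ≡ true → lookup P u ≡ false
      PAx u h rewrite lkP u | h = ∧-zeroʳ (lookup C u)
      PAf : ∀ u → lookup Af u ≡ true → lookup P u ≡ false
      PAf u h rewrite lkP u | h with lookup Ax u
      ... | true = ∧-zeroʳ (lookup C u)
      ... | false = ∧-zeroʳ (lookup C u)

      dxP : lookup P dx ≡ true
      dxP = inP dx (conn⇒reach T cx dx cxdxT) SX.side-∌d dxF
      dfP : lookup P df ≡ true
      dfP = inP df (conn⇒reach T cx df (cxcf ◅◅ cfdfT)) dfA SF.side-∌d

      PT : ∀ u → lookup P u ≡ true → Conn T' u dx
      PT u h with Pin u h
      ... | c , h1 , h2 = same-sides⇒conn (conn-sym (reach⇒conn T cx u c) ◅◅ cxdxT) (trans h1 (sym SX.side-∌d)) (trans h2 (sym dxF))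

      vP : ∀ Z → Sub Z → ∀ u → lookup P u ≡ true → lookup Z u ≡ lookup Z dx
      vP Z s u h = constant-on-T' Z s (PT u h)

      edgeC : ∀ {e u v} → Joins G e u v → lookup C u ≡ lookup C v
      edgeC {e} j = Cst (conn-joins (mx e) j)

      CLi : ∀ Z → Sub Z → lookup (δ G Z) x ≡ true → lookup (δ G Z) f ≡ true →
            ∀ e → lookup (δ G P) e ≡ true → lookup (δ G Z) e ≡ true
      CLi Z s zx zf e = δ⊆δ P Z e h
        where
        h : ∀ u v → Joins G e u v → lookup P u ≡ true → lookup P v ≡ false → lookup Z u ≢ lookup Z v
        h u v j pu pv eq with notP v pv (trans (sym (edgeC j)) (proj₁ (Pin u pu)))
        ... | inj₁ ax = δ∋x⇒separates Z zx (trans (sym (value-on-side-x Z s v ax)) (trans (sym eq) (vP Z s u pu)))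
        ... | inj₂ af = δ∋f⇒separates Z zf (trans (sym (value-on-side-f Z s v af)) (trans (sym eq) (trans (vP Z s u pu) (sym (vP Z s df dfP)))))

      δ-rest⊆D : ∀ e → lookup (δ G P) e ≡ true → Mem D e
      δ-rest⊆D e d with lookup P (end₁ e) in e1 | lookup P (end₂ e) in e2
      ... | true | true = ⊥-elim (δ≡true⇒≢ P e d (trans e1 (sym e2)))
      ... | false | false = ⊥-elim (δ≡true⇒≢ P e d (trans e1 (sym e2)))
      ... | true | false with notP (end₂ e) e2 (trans (sym (edgeC (joins-own e))) (proj₁ (Pin (end₁ e) e1)))
      ... | inj₁ ax = Mem-∪ˡ (δ G Ax) (δ G Af) e (≢⇒δ≡true Ax e (λ q → false≢true (trans (sym (proj₁ (proj₂ (Pin (end₁ e) e1)))) (trans q ax))))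
      ... | inj₂ af = Mem-∪ʳ (δ G Ax) (δ G Af) e (≢⇒δ≡true Af e (λ q → false≢true (trans (sym (proj₂ (proj₂ (Pin (end₁ e) e1)))) (trans q af))))
      δ-rest⊆D e d | false | true with notP (end₁ e) e1 (trans (edgeC (joins-own e)) (proj₁ (Pin (end₂ e) e2)))
      ... | inj₁ ax = Mem-∪ˡ (δ G Ax) (δ G Af) e (≢⇒δ≡true Ax e (λ q → false≢true (trans (sym (proj₁ (proj₂ (Pin (end₂ e) e2)))) (trans (sym q) ax))))
      ... | inj₂ af = Mem-∪ʳ (δ G Ax) (δ G Af) e (≢⇒δ≡true Af e (λ q → false≢true (trans (sym (proj₂ (proj₂ (Pin (end₂ e) e2)))) (trans (sym q) af))))

      Px : lookup (δ G P) x ≡ true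
      Px = trans (lookup-δ-ends P enx) (≢⇒xor≡true _ _ (λ q → false≢true (trans (sym (PAx cx SX.side-∋c)) (trans q dxP))))

      gAx : lookup (δ G Ax) g ≡ true
      gAx = trans (lookup-δ-joins Ax jg) (≢⇒xor≡true _ _ (λ q → false≢true (trans (sym (K1' v0 v0F)) (trans (sym q) u0A))))
        where
        K1' : ∀ v → lookup Af v ≡ true → lookup Ax v ≡ false
        K1' v h with lookup Ax v in e
        ... | false = refl
        ... | true = ⊥-elim (false≢true (trans (sym (sides-disjoint v e)) h))
      gAf : lookup (δ G Af) g ≡ true
      gAf = trans (lookup-δ-joins Af jg) (≢⇒xor≡true _ _ (λ q → false≢true (trans (sym (sides-disjoint u0 u0A)) (trans q v0F))))
      gP : lookup (δ G P) g ≡ false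
      gP = trans (lookup-δ-joins P jg) (≡⇒xor≡false _ _ (trans (PAx u0 u0A) (sym (PAf v0 v0F))))

      bothP : ∀ Z → Sub Z → lookup (δ G Z) x ≡ true → lookup (δ G Z) f ≡ true →
              (∀ e → lookup (δ G Z) e ≡ true → lookup (δ G P) e ≡ true) → δ G Z ≡ δ G P
      bothP Z s zx zf sub = Mem-antisym _ _ sub (CLi Z s zx zf)

      δ-rest-bond : IsBond G (δ G P)
      δ-rest-bond = (x , Mem⇒∈ Px) , (P , refl) , minim
        where
        minim : ∀ D′ → Nonempty D′ → IsCut G D′ → D′ ⊆ δ G P → D′ ≡ δ G P
        minim D′ (e , m) (Z , refl) sub' = go (lookup (δ G Z) x) refl (lookup (δ G Z) f) refl
          where
          sub : ∀ e → lookup (δ G Z) e ≡ true → lookup (δ G P) e ≡ true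
          sub e h = ∈⇒Mem (sub' (Mem⇒∈ h))
          s : Sub Z
          s e h = δ-rest⊆D e (sub e h)
          go : ∀ bx → lookup (δ G Z) x ≡ bx → ∀ bf → lookup (δ G Z) f ≡ bf → δ G Z ≡ δ G P
          go true zx true zf = bothP Z s zx zf sub
          go true zx false zf = ⊥-elim (false≢true (trans (sym gP) (sub g (trans (sym (cong (λ v → lookup v g) eqx)) gAx))))
            where
            eqx : δ G Ax ≡ δ G Z
            eqx = sym (SX.δ-side-unique Z e (∈⇒Mem m) only)
              where
              only : ∀ y → Mem T y → lookup (δ G Z) y ≡ true → y ≡ x
              only y yT h with δ∩T⊆xf Z s y yT h
              ... | inj₁ q = q
              ... | inj₂ refl = ⊥-elim (false≢true (trans (sym zf) h))
          go false zx true zf = ⊥-elim (false≢true (trans (sym gP) (sub g (trans (sym (cong (λ v → lookup v g) eqf)) gAf))))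
            where
            eqf : δ G Af ≡ δ G Z
            eqf = sym (SF.δ-side-unique Z e (∈⇒Mem m) only)
              where
              only : ∀ y → Mem T y → lookup (δ G Z) y ≡ true → y ≡ f
              only y yT h with δ∩T⊆xf Z s y yT h
              ... | inj₂ q = q
              ... | inj₁ refl = ⊥-elim (false≢true (trans (sym zx) h))
          go false zx false zf with δ-meets-spanning T mx Z e (∈⇒Mem m)
          ... | y , yT , h with δ∩T⊆xf Z s y yT h
          ... | inj₁ refl = ⊥-elim (false≢true (trans (sym zx) h))
          ... | inj₂ refl = ⊥-elim (false≢true (trans (sym zf) h))

      bonds-in-D-linked : ∀ Bd → IsBond G Bd → (∀ e → Mem Bd e → Mem D e) → Bd ≡ δ G Ax ⊎ (Bd ≡ δ G Af ⊎ Bd ≡ δ G P)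
      bonds-in-D-linked Bd ((e , m) , (Z , refl) , minim) sub = go (lookup (δ G Z) x) refl (lookup (δ G Z) f) refl
        where
        s : Sub Z
        s e h = sub e h
        go : ∀ bx → lookup (δ G Z) x ≡ bx → ∀ bf → lookup (δ G Z) f ≡ bf → δ G Z ≡ δ G Ax ⊎ (δ G Z ≡ δ G Af ⊎ δ G Z ≡ δ G P)
        go true zx true zf = inj₂ (inj₂ (sym (minim (δ G P) (x , Mem⇒∈ Px) (P , refl) (λ {e'} h → Mem⇒∈ (CLi Z s zx zf e' (∈⇒Mem h))))))
        go true zx false zf = inj₁ (only-x⇒side-x Z s e (∈⇒Mem m) zf)
        go false zx true zf = inj₂ (inj₁ (only-f⇒side-f Z s e (∈⇒Mem m) zx))
        go false zx false zf = ⊥-elim (meets-x-or-f Z s e (∈⇒Mem m) zx zf)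

      sides-tripartition : IsTripartition G Ax Af P
      sides-tripartition = (C , (ICC , δC) , uni) , dis1 , dis2 , dis3 , ICX , ICF , ICP ,
             (g , u0 , v0 , Mem⇒∈ u0A , Mem⇒∈ v0F , jg) ,
             (x , cx , dx , Mem⇒∈ SX.side-∋c , Mem⇒∈ dxP , ends⇒joins enx) ,
             (f , cf , df , Mem⇒∈ SF.side-∋c , Mem⇒∈ dfP , ends⇒joins enf)
        where
        ICC : InducesConnected G C
        ICC = (cx , Mem⇒∈ (conn⇒reach T cx cx ε)) ,
              λ u v mu mv → path-in-induced T C (λ a hy → trans (sym (Cst (a ◅ ε))) hy)
                              (conn-sym (reach⇒conn T cx u (∈⇒Mem mu)) ◅◅ reach⇒conn T cx v (∈⇒Mem mv)) (∈⇒Mem mu)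
        δC : δ G C ≡ ∅
        δC = lookup-ext _ _ (λ e → trans (≡⇒δ≡false C e (Cst (mx e))) (sym (lookup-∅ e)))
        uni : Ax ∪ (Af ∪ P) ≡ C
        uni = lookup-ext _ _ pt
          where
          pt : ∀ u → lookup (Ax ∪ (Af ∪ P)) u ≡ lookup C u
          pt u rewrite lookup-∪ Ax (Af ∪ P) u | lookup-∪ Af P u | lkP u with lookup Ax u in e1 | lookup Af u in e2
          ... | true | _ = sym (AxC u e1)
          ... | false | true = sym (AfC u e2)
          ... | false | false = ∧-identityʳ (lookup C u)
        dis1 : Ax ∩ Af ≡ ∅
        dis1 = lookup-ext _ _ λ u → trans (lookup-∩ Ax Af u) (trans (pt u) (sym (lookup-∅ u)))
          where
          pt : ∀ u → lookup Ax u ∧ lookup Af u ≡ false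
          pt u with lookup Ax u in e1
          ... | true = sides-disjoint u e1
          ... | false = refl
        dis2 : Ax ∩ P ≡ ∅
        dis2 = lookup-ext _ _ λ u → trans (lookup-∩ Ax P u) (trans (pt u) (sym (lookup-∅ u)))
          where
          pt : ∀ u → lookup Ax u ∧ lookup P u ≡ false
          pt u with lookup Ax u in e1
          ... | true = PAx u e1
          ... | false = refl
        dis3 : Af ∩ P ≡ ∅
        dis3 = lookup-ext _ _ λ u → trans (lookup-∩ Af P u) (trans (pt u) (sym (lookup-∅ u)))
          where
          pt : ∀ u → lookup Af u ∧ lookup P u ≡ false
          pt u with lookup Af u in e1
          ... | true = PAf u e1
          ... | false = refl
        ICX : InducesConnected G Ax
        ICX = (cx , Mem⇒∈ SX.side-∋c) ,
              λ u v mu mv → path-in-induced T' Ax (λ a hy → trans (sym (side-x-constant (a ◅ ε))) hy)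
                              (conn-sym (inAx u (∈⇒Mem mu)) ◅◅ inAx v (∈⇒Mem mv)) (∈⇒Mem mu)
        ICF : InducesConnected G Af
        ICF = (cf , Mem⇒∈ SF.side-∋c) ,
              λ u v mu mv → path-in-induced T' Af (λ a hy → trans (sym (side-f-constant (a ◅ ε))) hy)
                              (conn-sym (inAf u (∈⇒Mem mu)) ◅◅ inAf v (∈⇒Mem mv)) (∈⇒Mem mu)
        clP : ∀ {y z} → Adj G T' y z → lookup P y ≡ true → lookup P z ≡ true
        clP {y} {z} a hy with Pin y hy
        ... | c , h1 , h2 = inP z (trans (sym (Cst (conn-mono T'⊆T (a ◅ ε)))) c)
                                 (trans (sym (side-x-constant (a ◅ ε))) h1) (trans (sym (side-f-constant (a ◅ ε))) h2)
        ICP : InducesConnected G P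
        ICP = (dx , Mem⇒∈ dxP) ,
              λ u v mu mv → path-in-induced T' P clP (PT u (∈⇒Mem mu) ◅◅ conn-sym (PT v (∈⇒Mem mv))) (∈⇒Mem mu)

      Deq : D ≡ δ G Ax ∪ (δ G Af ∪ δ G P)
      Deq = lookup-ext _ _ pt
        where
        pt : ∀ e → lookup D e ≡ lookup (δ G Ax ∪ (δ G Af ∪ δ G P)) e
        pt e rewrite lookup-∪ (δ G Ax) (δ G Af) e | lookup-∪ (δ G Ax) (δ G Af ∪ δ G P) e | lookup-∪ (δ G Af) (δ G P) e
          with lookup (δ G Ax) e in e1 | lookup (δ G Af) e in e2 | lookup (δ G P) e in e3
        ... | true | _ | _ = refl
        ... | false | true | _ = refl
        ... | false | false | false = refl
        ... | false | false | true with Mem-∪⁻ (δ G Ax) (δ G Af) e (δ-rest⊆D e e3)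
        ... | inj₁ h = ⊥-elim (false≢true (trans (sym e1) h))
        ... | inj₂ h = ⊥-elim (false≢true (trans (sym e2) h))

      D-tribond : IsTribond G D
      D-tribond = Ax , Af , P , sides-tripartition , Deq

    bonds-in-D-unlinked : Unlinked → ∀ Bd → IsBond G Bd → (∀ e → Mem Bd e → Mem D e) → Bd ≡ δ G Ax ⊎ Bd ≡ δ G Af
    bonds-in-D-unlinked noaf Bd ((e , m) , (Z , refl) , minim) sub = go (lookup (δ G Z) x) refl (lookup (δ G Z) f) refl
      where
      s : Sub Z
      s e h = sub e h
      go : ∀ bx → lookup (δ G Z) x ≡ bx → ∀ bf → lookup (δ G Z) f ≡ bf → δ G Z ≡ δ G Ax ⊎ δ G Z ≡ δ G Af
      go true zx _ _ = inj₁ (sym (minim (δ G Ax) (x , Mem⇒∈ SX.δ-side-∋x) (Ax , refl) (λ {e'} h → Mem⇒∈ (δ-side⊆δ noaf Z s zx e' (∈⇒Mem h)))))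
      go false zx true zf = inj₂ (only-f⇒side-f Z s e (∈⇒Mem m) zx)
      go false zx false zf = ⊥-elim (meets-x-or-f Z s e (∈⇒Mem m) zx zf)

    ∁D-avoids-sides : ∀ e → Mem (∁ D) e → lookup (δ G Ax) e ≡ false × lookup (δ G Af) e ≡ false
    ∁D-avoids-sides e m with lookup (δ G Ax) e in e1 | lookup (δ G Af) e in e2
    ... | false | false = refl , refl
    ... | true | _ = ⊥-elim (true≢false (trans (sym (Mem-∪ˡ (δ G Ax) (δ G Af) e e1)) (trans (sym (B.not-involutive _)) (cong not (trans (sym (lookup-∁ D e)) m)))))
      where open import Data.Bool.Properties as B using ()
    ... | false | true = ⊥-elim (true≢false (trans (sym (Mem-∪ʳ (δ G Ax) (δ G Af) e e2)) (trans (sym (B.not-involutive _)) (cong not (trans (sym (lookup-∁ D e)) m)))))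
      where open import Data.Bool.Properties as B using ()

    conn-∁D⇒ : ∀ {u v} → Conn (∁ D) u v → Conn T u v × (lookup Ax u ≡ lookup Ax v) × (lookup Af u ≡ lookup Af v)
    conn-∁D⇒ c = conn-lift (λ e _ → mx e) c , conn⇒same-side (∁ D) Ax (λ e m → proj₁ (∁D-avoids-sides e m)) c , conn⇒same-side (∁ D) Af (λ e m → proj₂ (∁D-avoids-sides e m)) c

    T'⊆∁D : ∀ z → Mem T' z → Mem (∁ D) z
    T'⊆∁D z m rewrite lookup-∁ D z with lookup D z in eq
    ... | false = refl
    ... | true with T∩D z (T'⊆T z m) eq
    ... | inj₁ e = ⊥-elim (T'∌x z m e)
    ... | inj₂ e = ⊥-elim (T'∌f z m e)

    ⇒conn-∁D : ∀ {u v} → Conn T u v → lookup Ax u ≡ lookup Ax v → lookup Af u ≡ lookup Af v → Conn (∁ D) u v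
    ⇒conn-∁D c e1 e2 = conn-mono T'⊆∁D (same-sides⇒conn c e1 e2)

    conn-⊤⇒conn-T : ∀ {u v} → Conn full u v → Conn T u v
    conn-⊤⇒conn-T = conn-lift (λ e _ → mx e)
    conn-T⇒conn-⊤ : ∀ {u v} → Conn T u v → Conn full u v
    conn-T⇒conn-⊤ = conn-mono (λ e _ → lookup-⊤ e)

    component-label : ∀ {k0} → Bool → Bool → Fin k0 → Fin (suc (suc k0))
    component-label true _ i = zero
    component-label false true i = suc zero
    component-label false false i = suc (suc i)

    sides-disjoint′ : ∀ u → lookup Ax u ≡ true → lookup Af u ≡ true → ⊥₀
    sides-disjoint′ u h1 h2 = false≢true (trans (sym (sides-disjoint u h1)) h2)

    NC-∁D : ∀ k0 → NC full k0 → NC (∁ D) (suc (suc k0))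
    NC-∁D k0 (g0 , s0 , kk) = h , sh , kh
      where
      h : V → Fin (suc (suc k0))
      h u = component-label (lookup Ax u) (lookup Af u) (g0 u)
      gT : ∀ {u v} → Conn T u v → g0 u ≡ g0 v
      gT c = proj₂ (kk _ _) (conn-T⇒conn-⊤ c)
      sh : ∀ i → ∃[ u ] h u ≡ i
      sh zero = cx , cong (λ b → component-label b (lookup Af cx) (g0 cx)) SX.side-∋c
      sh (suc zero) = cf , trans (cong (λ b → component-label b (lookup Af cf) (g0 cf)) cfA) (cong (λ b → component-label false b (g0 cf)) SF.side-∋c)
      sh (suc (suc i)) with s0 i
      ... | w , gw with lookup Ax w in e1 | lookup Af w in e2
      ... | false | false = w , helper
        where helper : h w ≡ suc (suc i)
              helper rewrite e1 | e2 = cong (λ j → suc (suc j)) gw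
      ... | true | _ = dx , helper
        where helper : h dx ≡ suc (suc i)
              helper rewrite SX.side-∌d | dxF = cong (λ j → suc (suc j)) (trans (gT (conn-sym cxdxT ◅◅ cx-reaches-side w e1)) gw)
      ... | false | true = df , helper
        where helper : h df ≡ suc (suc i)
              helper rewrite SF.side-∌d | dfA = cong (λ j → suc (suc j)) (trans (gT (conn-sym cfdfT ◅◅ cf-reaches-side w e2)) gw)
      kh : ∀ u v → (h u ≡ h v → Conn (∁ D) u v) × (Conn (∁ D) u v → h u ≡ h v)
      kh u v with lookup Ax u in e1 | lookup Af u in e2 | lookup Ax v in e3 | lookup Af v in e4
      ... | true | true | _ | _ = ⊥-elim (sides-disjoint′ u e1 e2)
      ... | _ | _ | true | true = ⊥-elim (sides-disjoint′ v e3 e4)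
      ... | true | false | true | false = (λ _ → ⇒conn-∁D (conn-sym (cx-reaches-side u e1) ◅◅ cx-reaches-side v e3) (trans e1 (sym e3)) (trans e2 (sym e4))) , (λ _ → refl)
      ... | false | true | false | true = (λ _ → ⇒conn-∁D (conn-sym (cf-reaches-side u e2) ◅◅ cf-reaches-side v e4) (trans e1 (sym e3)) (trans e2 (sym e4))) , (λ _ → refl)
      ... | false | false | false | false =
            (λ q → ⇒conn-∁D (conn-⊤⇒conn-T (proj₁ (kk u v) (FP.suc-injective (FP.suc-injective q)))) (trans e1 (sym e3)) (trans e2 (sym e4))) ,
            (λ c → cong (λ j → suc (suc j)) (gT (proj₁ (conn-∁D⇒ c))))
      ... | true | false | false | true = (λ ()) , (λ c → ⊥-elim (true≢false (trans (sym e1) (trans (proj₁ (proj₂ (conn-∁D⇒ c))) e3))))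
      ... | true | false | false | false = (λ ()) , (λ c → ⊥-elim (true≢false (trans (sym e1) (trans (proj₁ (proj₂ (conn-∁D⇒ c))) e3))))
      ... | false | true | true | false = (λ ()) , (λ c → ⊥-elim (true≢false (trans (sym e3) (trans (sym (proj₁ (proj₂ (conn-∁D⇒ c)))) e1))))
      ... | false | false | true | false = (λ ()) , (λ c → ⊥-elim (true≢false (trans (sym e3) (trans (sym (proj₁ (proj₂ (conn-∁D⇒ c)))) e1))))
      ... | false | true | false | false = (λ ()) , (λ c → ⊥-elim (true≢false (trans (sym e2) (trans (proj₂ (proj₂ (conn-∁D⇒ c))) e4))))
      ... | false | false | false | true = (λ ()) , (λ c → ⊥-elim (true≢false (trans (sym e4) (trans (sym (proj₂ (proj₂ (conn-∁D⇒ c)))) e2))))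


module TripartitionBonds (G : Graph) where
  open Paths G

  module PartOfComponent (C P Q R : VS)
    (hC : ∀ u → Mem C u → Mem P u ⊎ (Mem Q u ⊎ Mem R u))
    (hPC : ∀ u → Mem P u → Mem C u)
    (dQP : ∀ u → Mem Q u → lookup P u ≡ false)
    (dRP : ∀ u → Mem R u → lookup P u ≡ false)
    (Cst : ∀ e → lookup C (end₁ e) ≡ lookup C (end₂ e))
    (cP : ∀ u v → Mem P u → Mem P v → Star (AdjIn G P) u v)
    (cQ : ∀ u v → Mem Q u → Mem Q v → Star (AdjIn G Q) u v)
    (cR : ∀ u v → Mem R u → Mem R v → Star (AdjIn G R) u v)
    (ePQ : EdgeBetween G P Q) (eQR : EdgeBetween G Q R) where

    p1 = proj₁ (proj₂ ePQ)
    q1 = proj₁ (proj₂ (proj₂ ePQ))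
    p1P : Mem P p1
    p1P = ∈⇒Mem (proj₁ (proj₂ (proj₂ (proj₂ ePQ))))
    q1Q : Mem Q q1
    q1Q = ∈⇒Mem (proj₁ (proj₂ (proj₂ (proj₂ (proj₂ ePQ)))))
    e1 = proj₁ ePQ
    j1 : Joins G e1 p1 q1
    j1 = proj₂ (proj₂ (proj₂ (proj₂ (proj₂ ePQ))))

    δPne : lookup (δ G P) e1 ≡ true
    δPne = trans (lookup-δ-joins P j1) (≢⇒xor≡true _ _ (λ q → false≢true (trans (sym (dQP q1 q1Q)) (sym (trans (sym p1P) q)))))

    module M (Z : VS) (sub : ∀ e → lookup (δ G Z) e ≡ true → lookup (δ G P) e ≡ true) where
      zfalse : ∀ e → lookup (δ G P) e ≡ false → lookup (δ G Z) e ≡ false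
      zfalse e h with lookup (δ G Z) e in eq
      ... | false = refl
      ... | true = ⊥-elim (false≢true (trans (sym h) (sub e eq)))

      constIn : ∀ (X : VS) → (∀ e u v → Joins G e u v → Mem X u → Mem X v → lookup (δ G P) e ≡ false) →
                ∀ {u v} → Star (AdjIn G X) u v → lookup Z u ≡ lookup Z v
      constIn X h = constant-along (lookup Z) (λ { (mu , mv , e , j) →
        xor≡false⇒≡ _ _ (trans (sym (lookup-δ-joins Z j)) (zfalse e (h e _ _ j (∈⇒Mem mu) (∈⇒Mem mv)))) })

      sameP : ∀ e u v → Joins G e u v → lookup P u ≡ lookup P v → lookup (δ G P) e ≡ false
      sameP e u v j eq = trans (lookup-δ-joins P j) (≡⇒xor≡false _ _ eq)

      zP : ∀ u → Mem P u → lookup Z u ≡ lookup Z p1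
      zP u h = constIn P (λ e u v j hu hv → sameP e u v j (trans hu (sym hv))) (cP u p1 h p1P)

      zQ : ∀ u → Mem Q u → lookup Z u ≡ lookup Z q1
      zQ u h = constIn Q (λ e u v j hu hv → sameP e u v j (trans (dQP u hu) (sym (dQP v hv)))) (cQ u q1 h q1Q)

      q2 = proj₁ (proj₂ eQR)
      r2 = proj₁ (proj₂ (proj₂ eQR))
      q2Q : Mem Q q2
      q2Q = ∈⇒Mem (proj₁ (proj₂ (proj₂ (proj₂ eQR))))
      r2R : Mem R r2
      r2R = ∈⇒Mem (proj₁ (proj₂ (proj₂ (proj₂ (proj₂ eQR)))))
      j2 = proj₂ (proj₂ (proj₂ (proj₂ (proj₂ eQR))))

      zR : ∀ u → Mem R u → lookup Z u ≡ lookup Z q1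
      zR u h = trans (constIn R (λ e u v j hu hv → sameP e u v j (trans (dRP u hu) (sym (dRP v hv)))) (cR u r2 h r2R))
                     (trans (sym (xor≡false⇒≡ _ _ (trans (sym (lookup-δ-joins Z j2)) (zfalse _ (sameP _ _ _ j2 (trans (dQP q2 q2Q) (sym (dRP r2 r2R))))))))
                            (zQ q2 q2Q))

      zOut : ∀ u → Mem C u → lookup P u ≡ false → lookup Z u ≡ lookup Z q1
      zOut u c np with hC u c
      ... | inj₁ h = ⊥-elim (false≢true (trans (sym np) h))
      ... | inj₂ (inj₁ h) = zQ u h
      ... | inj₂ (inj₂ h) = zR u h

      cross1 : ∀ e → lookup (δ G P) e ≡ true → ∀ u v → Joins G e u v → Mem P u → lookup P v ≡ false →
               lookup Z u ≢ lookup Z v → lookup Z p1 ≢ lookup Z q1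
      cross1 e d u v j pu pv ne eq = ne (trans (zP u pu) (trans eq (sym (zOut v cv pv))))
        where
        cv : Mem C v
        cv with joins⇒ends j
        ... | inj₁ (refl , refl) = trans (sym (Cst e)) (hPC u pu)
        ... | inj₂ (refl , refl) = trans (Cst e) (hPC u pu)

      sepPQ : ∀ e → lookup (δ G Z) e ≡ true → lookup Z p1 ≢ lookup Z q1
      sepPQ e h with lookup P (end₁ e) in ea | lookup P (end₂ e) in eb
      ... | true | false = cross1 e (sub e h) _ _ (joins-own e) ea eb (δ≡true⇒≢ Z e h)
      ... | false | true = cross1 e (sub e h) _ _ (joins-sym (joins-own e)) eb ea (λ q → δ≡true⇒≢ Z e h (sym q))
      ... | true | true = ⊥-elim (δ≡true⇒≢ P e (sub e h) (trans ea (sym eb)))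
      ... | false | false = ⊥-elim (δ≡true⇒≢ P e (sub e h) (trans ea (sym eb)))

      back : lookup Z p1 ≢ lookup Z q1 → ∀ e → lookup (δ G P) e ≡ true → lookup (δ G Z) e ≡ true
      back ne e d = δ⊆δ P Z e h d
        where
        h : ∀ u v → Joins G e u v → Mem P u → lookup P v ≡ false → lookup Z u ≢ lookup Z v
        h u v j pu pv eq = ne (trans (sym (zP u pu)) (trans eq (zOut v cv pv)))
          where
          cv : Mem C v
          cv with joins⇒ends j
          ... | inj₁ (refl , refl) = trans (sym (Cst e)) (hPC u pu)
          ... | inj₂ (refl , refl) = trans (Cst e) (hPC u pu)

    δ-part-bond : IsBond G (δ G P)
    δ-part-bond = (e1 , Mem⇒∈ δPne) , (P , refl) , minim
      where
      minim : ∀ D′ → Nonempty D′ → IsCut G D′ → D′ ⊆ δ G P → D′ ≡ δ G P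
      minim D′ (e , m) (Z , refl) s = Mem-antisym _ _ sub (back (sepPQ e (∈⇒Mem m)))
        where
        sub : ∀ e → lookup (δ G Z) e ≡ true → lookup (δ G P) e ≡ true
        sub e h = ∈⇒Mem (s (Mem⇒∈ h))
        open M Z sub

  disj : ∀ (X Y : VS) → X ∩ Y ≡ ∅ → ∀ u → Mem X u → lookup Y u ≡ false
  disj X Y eq u h with trans (sym (lookup-∩ X Y u)) (trans (cong (λ s → lookup s u) eq) (lookup-∅ u))
  ... | r rewrite h = r

  disj' : ∀ (X Y : VS) → X ∩ Y ≡ ∅ → ∀ u → Mem Y u → lookup X u ≡ false
  disj' X Y eq u h with lookup X u in e
  ... | false = refl
  ... | true = ⊥-elim (false≢true (trans (sym (disj X Y eq u e)) h))

  edge-between-sym : ∀ {X Y} → EdgeBetween G X Y → EdgeBetween G Y X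
  edge-between-sym (e , u , v , mu , mv , j) = e , v , u , mv , mu , joins-sym j

  tripartition-bonds : ∀ X₁ X₂ X₃ → IsTripartition G X₁ X₂ X₃ → IsBond G (δ G X₁) × IsBond G (δ G X₂) × IsBond G (δ G X₃)
  tripartition-bonds X₁ X₂ X₃ ((C , (icC , δC) , uni) , d12 , d13 , d23 , (_ , c1) , (_ , c2) , (_ , c3) , e12 , e13 , e23) =
    PartOfComponent.δ-part-bond C X₁ X₂ X₃ cover (λ u h → inC u (inj₁ h))
       (λ u h → disj' X₁ X₂ d12 u h) (λ u h → disj' X₁ X₃ d13 u h) Cst
       (λ u v a b → c1 u v (Mem⇒∈ a) (Mem⇒∈ b)) (λ u v a b → c2 u v (Mem⇒∈ a) (Mem⇒∈ b)) (λ u v a b → c3 u v (Mem⇒∈ a) (Mem⇒∈ b)) e12 e23 ,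
    PartOfComponent.δ-part-bond C X₂ X₁ X₃ (λ u h → ⊎swap2 (cover u h)) (λ u h → inC u (inj₂ (inj₁ h)))
       (λ u h → disj X₁ X₂ d12 u h) (λ u h → disj' X₂ X₃ d23 u h) Cst
       (λ u v a b → c2 u v (Mem⇒∈ a) (Mem⇒∈ b)) (λ u v a b → c1 u v (Mem⇒∈ a) (Mem⇒∈ b)) (λ u v a b → c3 u v (Mem⇒∈ a) (Mem⇒∈ b)) (edge-between-sym e12) e13 ,
    PartOfComponent.δ-part-bond C X₃ X₁ X₂ (λ u h → ⊎swap3 (cover u h)) (λ u h → inC u (inj₂ (inj₂ h)))
       (λ u h → disj X₁ X₃ d13 u h) (λ u h → disj X₂ X₃ d23 u h) Cst
       (λ u v a b → c3 u v (Mem⇒∈ a) (Mem⇒∈ b)) (λ u v a b → c1 u v (Mem⇒∈ a) (Mem⇒∈ b)) (λ u v a b → c2 u v (Mem⇒∈ a) (Mem⇒∈ b)) (edge-between-sym e13) e12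
    where
    lkU : ∀ u → lookup C u ≡ lookup X₁ u ∨ (lookup X₂ u ∨ lookup X₃ u)
    lkU u = trans (sym (cong (λ s → lookup s u) uni)) (trans (lookup-∪ X₁ (X₂ ∪ X₃) u) (cong (lookup X₁ u ∨_) (lookup-∪ X₂ X₃ u)))
    cover : ∀ u → Mem C u → Mem X₁ u ⊎ (Mem X₂ u ⊎ Mem X₃ u)
    cover u h with ∨≡true⇒⊎ _ _ (trans (sym (lkU u)) h)
    ... | inj₁ a = inj₁ a
    ... | inj₂ b = inj₂ (∨≡true⇒⊎ _ _ b)
    inC : ∀ u → Mem X₁ u ⊎ (Mem X₂ u ⊎ Mem X₃ u) → Mem C u
    inC u (inj₁ h) rewrite lkU u | h = refl
    inC u (inj₂ (inj₁ h)) rewrite lkU u | h with lookup X₁ u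
    ... | true = refl
    ... | false = refl
    inC u (inj₂ (inj₂ h)) rewrite lkU u | h with lookup X₁ u | lookup X₂ u
    ... | true | _ = refl
    ... | false | true = refl
    ... | false | false = refl
    Cst : ∀ e → lookup C (end₁ e) ≡ lookup C (end₂ e)
    Cst e = δ≡false⇒≡ C e (trans (cong (λ s → lookup s e) δC) (lookup-∅ e))
    ⊎swap2 : ∀ {A B C' : Set} → A ⊎ (B ⊎ C') → B ⊎ (A ⊎ C')
    ⊎swap2 (inj₁ a) = inj₂ (inj₁ a)
    ⊎swap2 (inj₂ (inj₁ b)) = inj₁ b
    ⊎swap2 (inj₂ (inj₂ c)) = inj₂ (inj₂ c)
    ⊎swap3 : ∀ {A B C' : Set} → A ⊎ (B ⊎ C') → C' ⊎ (A ⊎ B)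
    ⊎swap3 (inj₁ a) = inj₂ (inj₁ a)
    ⊎swap3 (inj₂ (inj₁ b)) = inj₂ (inj₂ b)
    ⊎swap3 (inj₂ (inj₂ c)) = inj₁ c

  edgeδ : ∀ {X Y} → (eb : EdgeBetween G X Y) → lookup X (proj₁ (proj₂ (proj₂ eb))) ≡ false →
          lookup (δ G X) (proj₁ eb) ≡ true
  edgeδ {X} (e , u , v , mu , mv , j) h = trans (lookup-δ-joins X j) (≢⇒xor≡true _ _ (λ q → false≢true (trans (sym h) (trans (sym q) (∈⇒Mem mu)))))

  edgeNδ : ∀ {X Y} Z → (eb : EdgeBetween G X Y) → lookup Z (proj₁ (proj₂ eb)) ≡ false →
           lookup Z (proj₁ (proj₂ (proj₂ eb))) ≡ false → lookup (δ G Z) (proj₁ eb) ≡ false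
  edgeNδ Z (e , u , v , mu , mv , j) h1 h2 = trans (lookup-δ-joins Z j) (≡⇒xor≡false _ _ (trans h1 (sym h2)))

  tripartition-cuts-distinct : ∀ X₁ X₂ X₃ → IsTripartition G X₁ X₂ X₃ →
                (δ G X₁ ≢ δ G X₂) × (δ G X₁ ≢ δ G X₃) × (δ G X₂ ≢ δ G X₃)
  tripartition-cuts-distinct X₁ X₂ X₃ (_ , d12 , d13 , d23 , _ , _ , _ , e12 , e13 , e23) =
    (λ eq → false≢true (trans (sym (edgeNδ X₂ e13 (disj X₁ X₂ d12 _ (∈⇒Mem (m1 e13))) (disj' X₂ X₃ d23 _ (∈⇒Mem (m2 e13)))))
                       (trans (sym (lookup-cong eq _)) (edgeδ e13 (disj' X₁ X₃ d13 _ (∈⇒Mem (m2 e13))))))) ,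
    (λ eq → false≢true (trans (sym (edgeNδ X₃ e12 (disj X₁ X₃ d13 _ (∈⇒Mem (m1 e12))) (disj X₂ X₃ d23 _ (∈⇒Mem (m2 e12)))))
                       (trans (sym (lookup-cong eq _)) (edgeδ e12 (disj' X₁ X₂ d12 _ (∈⇒Mem (m2 e12))))))) ,
    (λ eq → false≢true (trans (sym (edgeNδ X₃ e12 (disj X₁ X₃ d13 _ (∈⇒Mem (m1 e12))) (disj X₂ X₃ d23 _ (∈⇒Mem (m2 e12)))))
                       (trans (sym (lookup-cong eq _)) (trans (edgeδf e12) refl))))
    where
    m1 : ∀ {X Y} (eb : EdgeBetween G X Y) → proj₁ (proj₂ eb) ∈ X
    m1 (e , u , v , mu , mv , j) = mu
    m2 : ∀ {X Y} (eb : EdgeBetween G X Y) → proj₁ (proj₂ (proj₂ eb)) ∈ Y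
    m2 (e , u , v , mu , mv , j) = mv
    edgeδf : (eb : EdgeBetween G X₁ X₂) → lookup (δ G X₂) (proj₁ eb) ≡ true
    edgeδf (e , u , v , mu , mv , j) = trans (lookup-δ-joins X₂ j) (≢⇒xor≡true _ _ (λ q → false≢true (trans (sym (disj X₁ X₂ d12 u (∈⇒Mem mu))) (trans q (∈⇒Mem mv)))))


module Cocircuits (G : Graph) (L : ESet G → Bool) where
  open Paths G
  open TripartitionBonds G

  Cocircuit : Subset (suc (nE G)) → Set
  Cocircuit = IsCocircuitJ₀ G L

  open MatroidBases Cocircuit public

  UnionOfCuts : ES → Set
  UnionOfCuts D' = ∀ e → Mem D' e → ∃[ Y ] (lookup (δ G Y) e ≡ true × (∀ z → lookup (δ G Y) z ≡ true → Mem D' z))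

  cocircuit-edges : ∀ d0 D' → Cocircuit (d0 ∷ D') → UnionOfCuts D' × ∃[ e ] Mem D' e
  cocircuit-edges d0 D' (inj₁ (Bd , ((e , m) , (Y , refl) , _) , _ , eq)) rewrite ∷-injectiveʳ eq =
    (λ e h → Y , h , λ z h' → h') , e , ∈⇒Mem m
  cocircuit-edges d0 D' (inj₂ (inj₁ (Bd , ((e , m) , (Y , refl) , _) , _ , eq))) rewrite ∷-injectiveʳ eq =
    (λ e h → Y , h , λ z h' → h') , e , ∈⇒Mem m
  cocircuit-edges d0 D' (inj₂ (inj₂ (Tr , inj₁ (X₁ , X₂ , X₃ , tri , refl) , _ , eq))) rewrite ∷-injectiveʳ eq = cu , ne
    where
    U = δ G X₁ ∪ (δ G X₂ ∪ δ G X₃)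
    cu : UnionOfCuts U
    cu e h with Mem-∪⁻ (δ G X₁) _ e h
    ... | inj₁ h1 = X₁ , h1 , λ z h' → Mem-∪ˡ (δ G X₁) _ z h'
    ... | inj₂ h2 with Mem-∪⁻ (δ G X₂) (δ G X₃) e h2
    ... | inj₁ h3 = X₂ , h3 , λ z h' → Mem-∪ʳ (δ G X₁) _ z (Mem-∪ˡ (δ G X₂) (δ G X₃) z h')
    ... | inj₂ h3 = X₃ , h3 , λ z h' → Mem-∪ʳ (δ G X₁) _ z (Mem-∪ʳ (δ G X₂) (δ G X₃) z h')
    ne : ∃[ e ] Mem U e
    ne with tripartition-bonds X₁ X₂ X₃ tri
    ... | ((e , m) , _) , _ = e , Mem-∪ˡ (δ G X₁) _ e (∈⇒Mem m)
  cocircuit-edges d0 D' (inj₂ (inj₂ (Tr , inj₂ (B₁ , B₂ , (((e , m) , (Y₁ , refl) , _) , (_ , (Y₂ , refl) , _) , _) , refl , _) , _ , eq))) rewrite ∷-injectiveʳ eq = cu , e , Mem-∪ˡ (δ G Y₁) _ e (∈⇒Mem m)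
    where
    cu : UnionOfCuts (δ G Y₁ ∪ δ G Y₂)
    cu e h with Mem-∪⁻ (δ G Y₁) (δ G Y₂) e h
    ... | inj₁ h1 = Y₁ , h1 , λ z h' → Mem-∪ˡ (δ G Y₁) _ z h'
    ... | inj₂ h1 = Y₂ , h1 , λ z h' → Mem-∪ʳ (δ G Y₁) _ z h'

module BasesOfJ₀ (G : Graph) (L : ESet G → Bool) where
  open Paths G
  open ComponentCounting G
  open Forests G
  open FundamentalCuts G
  open TwoForestEdges G
  open TripartitionBonds G
  open Cocircuits G L

  module MaximalForestBasis (T : ES) (fT : Forest T) (mx : ∀ e → Conn T (end₁ e) (end₂ e)) where
    open MaximalForest T fT mx

    spanning-T : Spanning Cocircuit (false ∷ T)
    spanning-T (d0 ∷ D') isCoc with cocircuit-edges d0 D' isCoc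
    ... | cu , e , m with cu e m
    ... | Y , h , sub with δ-meets-spanning T mx Y e h
    ... | y , yT , hy = suc y , x∈p∩q⁺ {p = false ∷ T} {q = d0 ∷ D'} (Mem⇒∈ {p = false ∷ T} yT , Mem⇒∈ {p = d0 ∷ D'} (sub y hy))

    witness-T : ∀ y → Mem T y → ∃[ D ] (Cocircuit D × (∀ w' → w' ∈ (false ∷ T) → w' ∈ D → w' ≡ suc y))
    witness-T y yT with L (δ G (Side.Ax y yT (end₁ y) (end₂ y) (inj₁ (refl , refl)))) in eL
    ... | true = _ , inj₁ (_ , SY.δ-side-bond , eL , refl) , only
      where
      module SY = Side y yT (end₁ y) (end₂ y) (inj₁ (refl , refl))
      only : ∀ w' → w' ∈ (false ∷ T) → w' ∈ (false ∷ δ G SY.Ax) → w' ≡ suc y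
      only zero m _ = ⊥-elim (false≢true (∈⇒Mem m))
      only (suc z) m1 m2 = cong suc (SY.δ-side-∩T z (∈⇒Mem m1) (∈⇒Mem m2))
    ... | false = _ , inj₂ (inj₁ (_ , SY.δ-side-bond , eL , refl)) , only
      where
      module SY = Side y yT (end₁ y) (end₂ y) (inj₁ (refl , refl))
      only : ∀ w' → w' ∈ (false ∷ T) → w' ∈ (true ∷ δ G SY.Ax) → w' ≡ suc y
      only zero m _ = ⊥-elim (false≢true (∈⇒Mem m))
      only (suc z) m1 m2 = cong suc (SY.δ-side-∩T z (∈⇒Mem m1) (∈⇒Mem m2))

    basis-T : IsBasis Cocircuit (false ∷ T)
    basis-T = basis-by-witnesses _ spanning-T wit
      where
      wit : Witnessed (false ∷ T)
      wit zero m = ⊥-elim (false≢true (∈⇒Mem m))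
      wit (suc y) m = witness-T y (∈⇒Mem m)

    module WithoutEdge (f : Ed) (fTT : Mem T f) (Lf : ∀ c d → Ends f c d → L (δ G (reach (T - f) c)) ≡ false) where

      witness-T-f : ∀ x → Mem T x → x ≢ f → ∃[ D ] (Cocircuit D × (∀ w' → w' ∈ (true ∷ (T - f)) → w' ∈ D → w' ≡ suc x))
      witness-T-f x xT x≢f with side-avoiding x xT (end₁ f) | side-avoiding f fTT (end₁ x)
      ... | cx , dx , enx , fa | cf , df , enf , xa = main
        where
        open TwoEdges T fT mx x f xT fTT x≢f cx dx cf df enx enf fa xa
        LAf : L (δ G Af) ≡ false
        LAf = Lf cf df enf
        check : ∀ D' → (∀ z → Mem D' z → Mem D z) → ∀ w' → w' ∈ (true ∷ (T - f)) → w' ∈ (false ∷ D') → w' ≡ suc x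
        check D' sub zero _ m = ⊥-elim (false≢true (∈⇒Mem m))
        check D' sub (suc z) m1 m2 with T∩D z (Mem-remove⁻ T f z (∈⇒Mem m1)) (sub z (∈⇒Mem m2))
        ... | inj₁ e = cong suc e
        ... | inj₂ e = ⊥-elim (Mem-remove⇒≢ T f z (∈⇒Mem m1) e)
        main : ∃[ D' ] (Cocircuit D' × (∀ w' → w' ∈ (true ∷ (T - f)) → w' ∈ D' → w' ≡ suc x))
        main with L (δ G Ax) in eLx
        ... | true = _ , inj₁ (_ , SX.δ-side-bond , eLx , refl) , check (δ G Ax) (λ z h → Mem-∪ˡ (δ G Ax) (δ G Af) z h)
        ... | false with any? (λ e → ((lookup Ax (end₁ e) ∧ lookup Af (end₂ e)) ∨ (lookup Af (end₁ e) ∧ lookup Ax (end₂ e))) B.≟ true)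
        ... | yes (g , hg) = withG (∨≡true⇒⊎ _ _ hg)
          where
          fromWE : ∀ u0 v0 (jg : Joins G g u0 v0) (u0A : lookup Ax u0 ≡ true) (v0F : lookup Af v0 ≡ true) →
                   ∃[ D' ] (Cocircuit D' × (∀ w' → w' ∈ (true ∷ (T - f)) → w' ∈ D' → w' ≡ suc x))
          fromWE u0 v0 jg u0A v0F with L (δ G WE.P) in eLP
            where module WE = LinkedSides g u0 v0 jg u0A v0F
          ... | true = _ , inj₁ (_ , WE.δ-rest-bond , eLP , refl) , check (δ G WE.P) WE.δ-rest⊆D
            where module WE = LinkedSides g u0 v0 jg u0A v0F
          ... | false = _ , inj₂ (inj₂ (D , inj₁ WE.D-tribond , noL , refl)) , check D (λ z h → h)
            where
            module WE = LinkedSides g u0 v0 jg u0A v0F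
            noL : ContainsNoLBond G L D
            noL B bB LB sub with WE.bonds-in-D-linked B bB (λ e h → ∈⇒Mem (sub (Mem⇒∈ h)))
            ... | inj₁ refl = false≢true (trans (sym eLx) LB)
            ... | inj₂ (inj₁ refl) = false≢true (trans (sym LAf) LB)
            ... | inj₂ (inj₂ refl) = false≢true (trans (sym eLP) LB)
          withG : ((lookup Ax (end₁ g) ∧ lookup Af (end₂ g)) ≡ true) ⊎ ((lookup Af (end₁ g) ∧ lookup Ax (end₂ g)) ≡ true) →
                  ∃[ D' ] (Cocircuit D' × (∀ w' → w' ∈ (true ∷ (T - f)) → w' ∈ D' → w' ≡ suc x))
          withG (inj₁ h) = fromWE (end₁ g) (end₂ g) (joins-own g) (proj₁ (∧≡true⇒× _ _ h)) (proj₂ (∧≡true⇒× _ _ h))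
          withG (inj₂ h) = fromWE (end₂ g) (end₁ g) (joins-sym (joins-own g)) (proj₂ (∧≡true⇒× _ _ h)) (proj₁ (∧≡true⇒× _ _ h))
        ... | no nAF = _ , inj₂ (inj₂ (D , inj₂ (δ G Ax , δ G Af , modular , refl , notTri) , noL , refl)) , check D (λ z h → h)
          where
          noaf : Unlinked
          noaf e u v j hu hv with joins⇒ends j
          ... | inj₁ (refl , refl) = nAF (e , lem)
            where lem : ((lookup Ax (end₁ e) ∧ lookup Af (end₂ e)) ∨ (lookup Af (end₁ e) ∧ lookup Ax (end₂ e))) ≡ true
                  lem rewrite hu | hv = refl
          ... | inj₂ (refl , refl) = nAF (e , lem)
            where lem : ((lookup Ax (end₁ e) ∧ lookup Af (end₂ e)) ∨ (lookup Af (end₁ e) ∧ lookup Ax (end₂ e))) ≡ true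
                  lem rewrite hu | hv with lookup Ax (end₁ e) ∧ lookup Af (end₂ e)
                  ... | true = refl
                  ... | false = refl
          modular : IsModularPair G (δ G Ax) (δ G Af)
          modular = SX.δ-side-bond , SF.δ-side-bond , proj₁ (NC-exists full) , proj₂ (NC-exists full) , NC-∁D _ (proj₂ (NC-exists full))
          noL : ContainsNoLBond G L D
          noL B bB LB sub with bonds-in-D-unlinked noaf B bB (λ e h → ∈⇒Mem (sub (Mem⇒∈ h)))
          ... | inj₁ refl = false≢true (trans (sym eLx) LB)
          ... | inj₂ refl = false≢true (trans (sym LAf) LB)
          notTri : ¬ IsTribond G D
          notTri (X₁ , X₂ , X₃ , tri , eqT) with tripartition-bonds X₁ X₂ X₃ tri | tripartition-cuts-distinct X₁ X₂ X₃ tri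
          ... | b1 , b2 , b3 | n12 , n13 , n23 =
            pick (bonds-in-D-unlinked noaf _ b1 s1) (bonds-in-D-unlinked noaf _ b2 s2) (bonds-in-D-unlinked noaf _ b3 s3)
            where
            s1 : ∀ e → Mem (δ G X₁) e → Mem D e
            s1 e h = trans (lookup-cong eqT e) (Mem-∪ˡ (δ G X₁) _ e h)
            s2 : ∀ e → Mem (δ G X₂) e → Mem D e
            s2 e h = trans (lookup-cong eqT e) (Mem-∪ʳ (δ G X₁) _ e (Mem-∪ˡ (δ G X₂) (δ G X₃) e h))
            s3 : ∀ e → Mem (δ G X₃) e → Mem D e
            s3 e h = trans (lookup-cong eqT e) (Mem-∪ʳ (δ G X₁) _ e (Mem-∪ʳ (δ G X₂) (δ G X₃) e h))
            pick : _ → _ → _ → ⊥₀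
            pick (inj₁ a) (inj₁ b) _ = n12 (trans a (sym b))
            pick (inj₂ a) (inj₂ b) _ = n12 (trans a (sym b))
            pick (inj₁ a) (inj₂ b) (inj₁ c) = n13 (trans a (sym c))
            pick (inj₁ a) (inj₂ b) (inj₂ c) = n23 (trans b (sym c))
            pick (inj₂ a) (inj₁ b) (inj₁ c) = n23 (trans b (sym c))
            pick (inj₂ a) (inj₁ b) (inj₂ c) = n13 (trans a (sym c))


  edgesWhere : (Ed → Bool) → List Ed
  edgesWhere p = filter (λ e → p e B.≟ true) (allFin (nE G))

  ∈-edgesWhere : ∀ p e → p e ≡ true → e ∈L edgesWhere p
  ∈-edgesWhere p e h = ∈-filter⁺ (λ e → p e B.≟ true) (∈-allFin e) h

  record SpanningForestOf (X : ES) : Set where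
    field
      F : ES
      forest : Forest F
      sub : ∀ z → Mem F z → Mem X z
      conn : ∀ e → Mem X e → Conn F (end₁ e) (end₂ e)

  spanning-forest : ∀ X → SpanningForestOf X
  spanning-forest X = record { F = O.F ; forest = O.forest ; sub = sb ; conn = λ e h → O.conn e (∈-edgesWhere (lookup X) e h) }
    where
    module O = GreedyForest (greedy-forest ∅ forest-∅ (edgesWhere (lookup X)))
    sb : ∀ z → Mem O.F z → Mem X z
    sb z m with O.sub z m
    ... | inj₁ h = ⊥-elim (false≢true (trans (sym (lookup-∅ z)) h))
    ... | inj₂ h = proj₂ (∈-filter⁻ (λ e → lookup X e B.≟ true) {xs = allFin (nE G)} h)

  record MaximalExtension (F : ES) : Set where
    field
      T : ES
      forest : Forest T
      sup : ∀ z → Mem F z → Mem T z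
      mx : ∀ e → Conn T (end₁ e) (end₂ e)

  maximal-extension : ∀ F → Forest F → MaximalExtension F
  maximal-extension F fF = record { T = O.F ; forest = O.forest ; sup = O.sup ; mx = λ e → O.conn e (∈-allFin e) }
    where
    module O = GreedyForest (greedy-forest F fF (allFin (nE G)))

  +2≰+1 : ∀ a k n → a + suc (suc k) ≤ n → n ≤ suc a + k → ⊥₀
  +2≰+1 a k n h1 h2 = NP.<-irrefl refl (NP.≤-trans (NP.≤-reflexive (sym eq)) (NP.≤-trans h1 h2))
    where
    eq : a + suc (suc k) ≡ suc (suc (a + k))
    eq = trans (NP.+-suc a (suc k)) (cong suc (NP.+-suc a k))

  record BasisWithE₀ (F : ES) : Set where
    field
      S0 : ES
      basis : IsBasis Cocircuit (true ∷ S0)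
      Fsub : ∀ z → Mem F z → Mem S0 z

  -- Extend F to a maximal forest T₁ of G - B₀ and add an edge f of B₀, giving a maximal
  -- forest T of G. Then T₁ + e₀ is a basis: B₀ + e₀ meets it only in e₀, and each x ∈ T₁
  -- is the only element on some cocircuit inside the union of the fundamental bonds of x
  -- and f (see TwoEdges).
  basis-with-e₀ : ∀ F → Forest F → ∀ B₀ → IsBond G B₀ → L B₀ ≡ false → (∀ z → Mem F z → lookup B₀ z ≡ false) → BasisWithE₀ F
  basis-with-e₀ F fF B₀ bB@((f , mf) , (Y , refl) , minB) LB disj =
    record { S0 = T - f ; basis = basis-by-witnesses _ spanU witU ; Fsub = fsub }
    where
    module O = GreedyForest (greedy-forest F fF (edgesWhere (λ e → not (lookup (δ G Y) e))))
    T1 = O.F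
    fY : lookup (δ G Y) f ≡ true
    fY = ∈⇒Mem mf
    T1noB : ∀ z → Mem T1 z → lookup (δ G Y) z ≡ false
    T1noB z m with O.sub z m
    ... | inj₁ h = disj z h
    ... | inj₂ h with lookup (δ G Y) z | proj₂ (∈-filter⁻ (λ e → not (lookup (δ G Y) e) B.≟ true) {xs = allFin (nE G)} h)
    ... | false | _ = refl
    ... | true | ()
    connNot : ∀ e → lookup (δ G Y) e ≡ false → Conn T1 (end₁ e) (end₂ e)
    connNot e h = O.conn e (∈-edgesWhere (λ e → not (lookup (δ G Y) e)) e (cong not h))
    stT1 : ∀ {u v} → Conn T1 u v → lookup Y u ≡ lookup Y v
    stT1 = conn⇒same-side T1 Y T1noB
    fnc : ¬ Conn T1 (end₁ f) (end₂ f)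
    fnc c = δ≡true⇒≢ Y f fY (stT1 c)
    T = T1 ∪ ⁅ f ⁆
    fT : Forest T
    fT = forest-add T1 f O.forest fnc
    T1T : ∀ z → Mem T1 z → Mem T z
    T1T z = Mem-∪ˡ T1 ⁅ f ⁆ z
    fTT : Mem T f
    fTT = Mem-∪ʳ T1 ⁅ f ⁆ f (Mem-⁅x⁆ f)
    sideEq : ∀ w → lookup (reach T1 w) (end₁ f) ≢ lookup (reach T1 w) (end₂ f) → δ G (reach T1 w) ≡ δ G Y
    sideEq w ne = minB _ (f , Mem⇒∈ (≢⇒δ≡true (reach T1 w) f ne)) (reach T1 w , refl) sub
      where
      sub : δ G (reach T1 w) ⊆ δ G Y
      sub {e} m with lookup (δ G Y) e in eq
      ... | true = refl-mem
        where refl-mem = Mem⇒∈ eq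
      ... | false = ⊥-elim (δ≡true⇒≢ (reach T1 w) e (∈⇒Mem m) (reach-constant T1 w (connNot e eq)))
    Za = reach T1 (end₁ f)
    Zb = reach T1 (end₂ f)
    Zaf : lookup Za (end₁ f) ≡ true
    Zaf = conn⇒reach T1 (end₁ f) (end₁ f) ε
    Zbf : lookup Zb (end₂ f) ≡ true
    Zbf = conn⇒reach T1 (end₂ f) (end₂ f) ε
    Zab : lookup Za (end₂ f) ≡ false
    Zab with lookup Za (end₂ f) in eq
    ... | true = ⊥-elim (fnc (reach⇒conn T1 (end₁ f) (end₂ f) eq))
    ... | false = refl
    Zba : lookup Zb (end₁ f) ≡ false
    Zba with lookup Zb (end₁ f) in eq
    ... | true = ⊥-elim (fnc (conn-sym (reach⇒conn T1 (end₂ f) (end₁ f) eq)))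
    ... | false = refl
    eqA : δ G Za ≡ δ G Y
    eqA = sideEq (end₁ f) (λ q → false≢true (trans (sym Zab) (sym (trans (sym Zaf) q))))
    eqB : δ G Zb ≡ δ G Y
    eqB = sideEq (end₂ f) (λ q → false≢true (trans (sym Zba) (trans q Zbf)))
    notBoth : ∀ u → lookup Za u ≡ true → lookup Zb u ≡ true → ⊥₀
    notBoth u h1 h2 = fnc (reach⇒conn T1 (end₁ f) u h1 ◅◅ conn-sym (reach⇒conn T1 (end₂ f) u h2))
    cT : ∀ {u v} → Conn T1 u v → Conn T u v
    cT = conn-mono T1T
    mx : ∀ e → Conn T (end₁ e) (end₂ e)
    mx e with lookup (δ G Y) e in eq
    ... | false = cT (connNot e eq)
    ... | true with lookup Za (end₁ e) in ea | lookup Za (end₂ e) in eb | lookup Zb (end₁ e) in ec | lookup Zb (end₂ e) in ed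
    ... | true | true | _ | _ = ⊥-elim (δ≡true⇒≢ Za e (trans (lookup-cong eqA e) eq) (trans ea (sym eb)))
    ... | false | false | _ | _ = ⊥-elim (δ≡true⇒≢ Za e (trans (lookup-cong eqA e) eq) (trans ea (sym eb)))
    ... | _ | _ | true | true = ⊥-elim (δ≡true⇒≢ Zb e (trans (lookup-cong eqB e) eq) (trans ec (sym ed)))
    ... | _ | _ | false | false = ⊥-elim (δ≡true⇒≢ Zb e (trans (lookup-cong eqB e) eq) (trans ec (sym ed)))
    ... | true | false | true | false = ⊥-elim (notBoth _ ea ec)
    ... | false | true | false | true = ⊥-elim (notBoth _ eb ed)
    ... | true | false | false | true = conn-sym (cT (reach⇒conn T1 (end₁ f) (end₁ e) ea)) ◅◅ edge⇒conn f fTT ◅◅ cT (reach⇒conn T1 (end₂ f) (end₂ e) ed)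
    ... | false | true | true | false = conn-sym (cT (reach⇒conn T1 (end₂ f) (end₁ e) ec)) ◅◅ conn-sym (edge⇒conn f fTT) ◅◅ cT (reach⇒conn T1 (end₁ f) (end₂ e) eb)
    TB : ∀ z → Mem T z → lookup (δ G Y) z ≡ true → z ≡ f
    TB z m h with Mem-∪⁻ T1 ⁅ f ⁆ z m
    ... | inj₁ h1 = ⊥-elim (false≢true (trans (sym (T1noB z h1)) h))
    ... | inj₂ h1 = Mem-⁅y⁆ f z h1
    open FundamentalCuts.MaximalForest G T fT mx
    open MaximalForestBasis T fT mx
    Lf : ∀ c d → Ends f c d → L (δ G (reach (T - f) c)) ≡ false
    Lf c d en = trans (cong L (sym (Side.δ-side-unique f fTT c d en Y f fY TB))) LB
    open WithoutEdge f fTT Lf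
    fsub : ∀ z → Mem F z → Mem (T - f) z
    fsub z m = Mem-remove⁺ T f z (λ e → false≢true (trans (sym (disj z m)) (trans (cong (lookup (δ G Y)) e) fY))) (T1T z (O.sup z m))
    witU : Witnessed (true ∷ (T - f))
    witU zero m = true ∷ δ G Y , inj₂ (inj₁ (δ G Y , bB , LB , refl)) , only
      where
      only : ∀ w' → w' ∈ (true ∷ (T - f)) → w' ∈ (true ∷ δ G Y) → w' ≡ zero
      only zero _ _ = refl
      only (suc z) m1 m2 = ⊥-elim (Mem-remove⇒≢ T f z (∈⇒Mem m1) (TB z (Mem-remove⁻ T f z (∈⇒Mem m1)) (∈⇒Mem m2)))
    witU (suc x) m = witness-T-f x (Mem-remove⁻ T f x (∈⇒Mem m)) (Mem-remove⇒≢ T f x (∈⇒Mem m))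
    module SF0 = Side f fTT (end₁ f) (end₂ f) (inj₁ (refl , refl))
    -- A cocircuit missing e₀ and T - f has all its bonds equal to the fundamental cut B₀ of f:
    -- it is then not in L, not a tribond (whose three cuts differ), and not a dibond, since
    -- deleting B₀ alone adds only one component.
    spanU : Spanning Cocircuit (true ∷ (T - f))
    spanU (true ∷ D') isCoc = zero , x∈p∩q⁺ {p = true ∷ (T - f)} {q = true ∷ D'} (Mem⇒∈ {p = true ∷ (T - f)} refl , Mem⇒∈ {p = true ∷ D'} refl)
    spanU (false ∷ D') isCoc with nonempty? ((true ∷ (T - f)) ∩ (false ∷ D'))
    ... | yes ne = ne
    ... | no ne = ⊥-elim (contra isCoc)
      where
      inI : ∀ y → Mem (T - f) y → Mem D' y → ⊥₀
      inI y h1 h2 = ne (suc y , x∈p∩q⁺ {p = true ∷ (T - f)} {q = false ∷ D'} (Mem⇒∈ {p = true ∷ (T - f)} h1 , Mem⇒∈ {p = false ∷ D'} h2))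
      onlyf : ∀ Z e → lookup (δ G Z) e ≡ true → (∀ z → lookup (δ G Z) z ≡ true → Mem D' z) → δ G Z ≡ δ G SF0.Ax
      onlyf Z e h sub = SF0.δ-side-unique Z e h only
        where
        only : ∀ y → Mem T y → lookup (δ G Z) y ≡ true → y ≡ f
        only y yT hy with y F.≟ f
        ... | yes q = q
        ... | no nq = ⊥-elim (inI y (Mem-remove⁺ T f y nq yT) (sub y hy))
      LAf0 : L (δ G SF0.Ax) ≡ false
      LAf0 = Lf (end₁ f) (end₂ f) (inj₁ (refl , refl))
      contra : Cocircuit (false ∷ D') → ⊥₀
      contra (inj₁ (Bd , ((e , me) , (Z , refl) , _) , LBd , eq)) =
        false≢true (trans (sym LAf0) (trans (cong L (sym (onlyf Z e (∈⇒Mem me) λ z h → trans (lookup-cong (∷-injectiveʳ eq) z) h))) LBd))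
      contra (inj₂ (inj₁ (_ , _ , _ , eq))) = false≢true (proj₁ (∷-injective eq))
      contra (inj₂ (inj₂ (Tr , inj₁ (X₁ , X₂ , X₃ , tri , refl) , _ , eq))) with tripartition-bonds X₁ X₂ X₃ tri
      ... | ((e1 , m1) , _) , ((e2 , m2) , _) , _ =
        proj₁ (tripartition-cuts-distinct X₁ X₂ X₃ tri)
          (trans (onlyf X₁ e1 (∈⇒Mem m1) (λ z h → trans (lookup-cong (∷-injectiveʳ eq) z) (Mem-∪ˡ (δ G X₁) _ z h)))
                 (sym (onlyf X₂ e2 (∈⇒Mem m2) (λ z h → trans (lookup-cong (∷-injectiveʳ eq) z) (Mem-∪ʳ (δ G X₁) _ z (Mem-∪ˡ (δ G X₂) (δ G X₃) z h))))))
      contra (inj₂ (inj₂ (Tr , inj₂ (_ , _ , (((e1 , m1) , (Z1 , refl) , _) , ((e2 , m2) , (Z2 , refl) , _) , k , ncT , ncC) , refl , _) , _ , eq))) =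
        +2≰+1 ∣ T - f ∣ k (nV G) (proj₂ (forest-count (T - f) (suc (suc k)) ncTf) (forest-⊆ T (T - f) fT (Mem-remove⁻ T f)))
              (NP.≤-trans (proj₁ (forest-count T k ncTT)) (NP.≤-reflexive (cong (_+ k) (∣p∣≡1+∣p-x∣ T f fTT))))
        where
        W = δ G SF0.Ax
        e1W : δ G Z1 ≡ W
        e1W = onlyf Z1 e1 (∈⇒Mem m1) (λ z h → trans (lookup-cong (∷-injectiveʳ eq) z) (Mem-∪ˡ (δ G Z1) _ z h))
        e2W : δ G Z2 ≡ W
        e2W = onlyf Z2 e2 (∈⇒Mem m2) (λ z h → trans (lookup-cong (∷-injectiveʳ eq) z) (Mem-∪ʳ (δ G Z1) _ z h))
        notW : ∀ e → Mem (∁ (δ G Z1 ∪ δ G Z2)) e → lookup W e ≡ false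
        notW e m with lookup W e in eW
        ... | false = refl
        ... | true = ⊥-elim (false≢true (trans (sym (trans (lookup-∁ (δ G Z1 ∪ δ G Z2) e) (cong not (Mem-∪ˡ (δ G Z1) _ e (trans (lookup-cong e1W e) eW))))) m))
        toTf : ∀ e → Mem (∁ (δ G Z1 ∪ δ G Z2)) e → Conn (T - f) (end₁ e) (end₂ e)
        toTf e m with SF0.conn-via-x e
        ... | inj₁ p = p
        ... | inj₂ (inj₁ (p , q)) = ⊥-elim (δ≡true⇒≢ SF0.Ax e (SF0-cross p q) (notW' e m))
          where
          SF0-cross : Conn (T - f) (end₁ e) (end₁ f) → Conn (T - f) (end₂ f) (end₂ e) → lookup (δ G SF0.Ax) e ≡ true
          SF0-cross p q = ≢⇒δ≡true SF0.Ax e (λ r → SF0.side-separates-x (trans (sym (SF0.side-constant p)) (trans r (sym (SF0.side-constant q)))))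
          notW' : ∀ e → Mem (∁ (δ G Z1 ∪ δ G Z2)) e → lookup SF0.Ax (end₁ e) ≡ lookup SF0.Ax (end₂ e)
          notW' e m = δ≡false⇒≡ SF0.Ax e (notW e m)
        ... | inj₂ (inj₂ (p , q)) = ⊥-elim (SF0.side-separates-x (trans (SF0.side-constant q) (trans (sym (δ≡false⇒≡ SF0.Ax e (notW e m))) (SF0.side-constant p))))
        fromTf : ∀ z → Mem (T - f) z → Mem (∁ (δ G Z1 ∪ δ G Z2)) z
        fromTf z m = trans (lookup-∁ (δ G Z1 ∪ δ G Z2) z) (cong not (trans (lookup-∪ (δ G Z1) (δ G Z2) z)
                       (trans (cong₂ _∨_ (lookup-cong e1W z) (lookup-cong e2W z)) (trans (cong (λ b → b ∨ b) (SF0.δ-side-∌ z (Mem-remove⁻ T f z m) (Mem-remove⇒≢ T f z m))) refl))))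
        ncTf : NC (T - f) (suc (suc k))
        ncTf = NC-cong (λ u v c → conn-lift toTf c) (λ u v c → conn-mono fromTf c) ncC
        ncTT : NC T k
        ncTT = NC-cong (λ u v c → conn-lift (λ e _ → mx e) c) (λ u v c → conn-mono (λ e _ → lookup-⊤ e) c) ncT


module IndependentSets (G : Graph) (L : ESet G → Bool) where
  open Paths G
  open ComponentCounting G
  open Forests G
  open Cocircuits G L

  module IndependentBound (X : ES) (k : ℕ) (ncX : NC X k) (B : Subset (suc (nE G))) (bB : IsBasis Cocircuit B)
            (i0 : Bool) (I' : ES) (IX : (i0 ∷ I') ⊆ (true ∷ X)) (IB : (i0 ∷ I') ⊆ B) where
    I'X : ∀ z → Mem I' z → Mem X z
    I'X z h = ⊆⇒Mem IX (suc z) h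
    I'B : ∀ z → Mem I' z → lookup B (suc z) ≡ true
    I'B z h = ⊆⇒Mem IB (suc z) h

    independent-forest : Forest I'
    independent-forest e me c = basis-minus-not-spanning B (suc e) bB (I'B e me) sp
      where
      sp : Spanning Cocircuit (B - suc e)
      sp (d0 ∷ D') isCoc with nonempty? ((B - suc e) ∩ (d0 ∷ D'))
      ... | yes ne = ne
      ... | no ne = ⊥-elim go
        where
        go : ⊥₀
        go with proj₁ bB (d0 ∷ D') isCoc
        ... | w , m with x∈p∩q⁻ B (d0 ∷ D') m
        ... | wB , wD with w F.≟ suc e
        ... | no nw = ne (w , x∈p∩q⁺ (Mem⇒∈ (Mem-remove⁺ B (suc e) w nw (∈⇒Mem wB)) , wD))
        ... | yes refl with proj₁ (cocircuit-edges d0 D' isCoc) e (∈⇒Mem wD)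
        ... | Y , hY , subY with conn-crosses-δ (I' - e) Y c (δ≡true⇒≢ Y e hY)
        ... | z , zI , hz = ne (suc z , x∈p∩q⁺ (Mem⇒∈ (Mem-remove⁺ B (suc e) (suc z) (λ q → Mem-remove⇒≢ I' e z zI (FP.suc-injective q)) (I'B z (Mem-remove⁻ I' e z zI))) ,
                                                 Mem⇒∈ {p = d0 ∷ D'} (subY z hz)))

    ∣I∣+k≤n : ∣ I' ∣ + k ≤ nV G
    ∣I∣+k≤n = forest-within-bound I' X k ncX independent-forest (λ e h → edge⇒conn e (I'X e h))

    -- If e₀ is in the basis, some cocircuit B' + e₀ meets it only in e₀. As X is cobalanced
    -- and B' ∉ L, an edge z of B' has its ends joined in X but, B' being a cut missing I',
    -- not in I'; so I' + z is a larger forest inside the components of X.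
    ∣I∣+1+k≤n : i0 ≡ true → Cobalanced G L X → ∣ I' ∣ + suc k ≤ nV G
    ∣I∣+1+k≤n refl cob with (∣ I' ∣ + suc k) NP.≤? nV G
    ... | yes p = p
    ... | no np = ⊥-elim (basis-minus-not-spanning B zero bB (⊆⇒Mem IB zero refl) sp)
      where
      sp : Spanning Cocircuit (B - zero)
      sp (false ∷ D') isCoc with nonempty? ((B - zero) ∩ (false ∷ D'))
      ... | yes ne = ne
      ... | no ne = ⊥-elim go
        where
        go : ⊥₀
        go with proj₁ bB (false ∷ D') isCoc
        ... | w , m with x∈p∩q⁻ B (false ∷ D') m
        ... | wB , wD with w F.≟ zero
        ... | no nw = ne (w , x∈p∩q⁺ (Mem⇒∈ (Mem-remove⁺ B zero w nw (∈⇒Mem wB)) , wD))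
        ... | yes refl = false≢true (∈⇒Mem wD)
      sp (true ∷ D') isCoc with nonempty? ((B - zero) ∩ (true ∷ D'))
      ... | yes ne = ne
      ... | no ne = ⊥-elim (np (go isCoc))
        where
        go : Cocircuit (true ∷ D') → ∣ I' ∣ + suc k ≤ nV G
        go (inj₁ (_ , _ , _ , eq)) = ⊥-elim (false≢true (sym (proj₁ (∷-injective eq))))
        go (inj₂ (inj₂ (_ , _ , _ , eq))) = ⊥-elim (false≢true (sym (proj₁ (∷-injective eq))))
        go (inj₂ (inj₁ (Bd , bBd@(_ , (Y , refl) , _) , LBd , eq))) = final
          where
          disjB : ∀ z → Mem I' z → lookup (δ G Y) z ≡ true → ⊥₀
          disjB z zI hz = ne (suc z , x∈p∩q⁺ (Mem⇒∈ (Mem-remove⁺ B zero (suc z) (λ ()) (I'B z zI)) , Mem⇒∈ {p = true ∷ D'} (trans (lookup-cong (∷-injectiveʳ eq) z) hz)))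
          findZ : Dec (∃[ z ] (lookup (δ G Y) z ≡ true × Conn X (end₁ z) (end₂ z)))
          findZ = any? (λ z → (lookup (δ G Y) z B.≟ true) ×-dec conn? X (end₁ z) (end₂ z))
          final : ∣ I' ∣ + suc k ≤ nV G
          final with findZ
          ... | no nz = ⊥-elim (false≢true (trans (sym LBd) (cob (δ G Y) bBd (λ e me c → nz (e , ∈⇒Mem me , c)))))
          ... | yes (z , hz , cz) =
            NP.≤-trans (NP.≤-reflexive (NP.+-suc ∣ I' ∣ k))
              (subst (λ m → m + k ≤ nV G) (∣p∪⁅x⁆∣≡1+∣p∣ I' z z∉I)
                (forest-within-bound (I' ∪ ⁅ z ⁆) X k ncX (forest-add I' z independent-forest z-bridge) I+z⊆X))
            where
            z-bridge : ¬ Conn I' (end₁ z) (end₂ z)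
            z-bridge c with conn-crosses-δ I' Y c (δ≡true⇒≢ Y z hz)
            ... | y , yI , hy = disjB y yI hy
            z∉I : lookup I' z ≡ false
            z∉I with lookup I' z in eq
            ... | false = refl
            ... | true = ⊥-elim (z-bridge (edge⇒conn z eq))
            I+z⊆X : ∀ e → Mem (I' ∪ ⁅ z ⁆) e → Conn X (end₁ e) (end₂ e)
            I+z⊆X e m with Mem-∪⁻ I' ⁅ z ⁆ e m
            ... | inj₁ h = edge⇒conn e (I'X e h)
            ... | inj₂ h rewrite Mem-⁅y⁆ z e h = cz


module Rank (G : Graph) (L : ESet G → Bool) where
  open Paths G
  open ComponentCounting G
  open Forests G
  open Cocircuits G L
  open BasesOfJ₀ G L
  open IndependentSets G L

  cut? : ∀ D → Dec (IsCut G D)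
  cut? D = anySubset? (λ Y → ≡-dec B._≟_ D (δ G Y))

  minimal-cut? : ∀ D → Dec (∀ D′ → Nonempty D′ → IsCut G D′ → D′ ⊆ D → D′ ≡ D)
  minimal-cut? D with anySubset? (λ D′ → nonempty? D′ ×-dec (cut? D′ ×-dec ((D′ ⊆? D) ×-dec ¬? (≡-dec B._≟_ D′ D))))
  ... | yes (D′ , ne , c , s , neq) = no (λ h → neq (h D′ ne c s))
  ... | no n = yes λ D′ ne c s → stable D′ ne c s
    where
    stable : ∀ D′ → Nonempty D′ → IsCut G D′ → D′ ⊆ D → D′ ≡ D
    stable D′ ne c s with ≡-dec B._≟_ D′ D
    ... | yes e = e
    ... | no neq = ⊥-elim (n (D′ , ne , c , s , neq))

  bond? : ∀ D → Dec (IsBond G D)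
  bond? D = nonempty? D ×-dec (cut? D ×-dec minimal-cut? D)

  uncobalanced⇒bond : ∀ X → ¬ Cobalanced G L X →
                      ∃[ B ] (IsBond G B × L B ≡ false × (∀ e → e ∈ B → InExt G L X e))
  uncobalanced⇒bond X ¬cob
    with anySubset? (λ B → bond? B ×-dec ((L B B.≟ false) ×-dec all? (λ e → (e ∈? B) →-dec ¬? (conn? X (end₁ e) (end₂ e)))))
  ... | yes found = found
  ... | no none = ⊥-elim (¬cob cobalanced)
    where
    cobalanced : Cobalanced G L X
    cobalanced B isBond ext with L B in eq
    ... | true = refl
    ... | false = ⊥-elim (none (B , isBond , eq , ext))

  independent-bound : ∀ (X : ES) r → (∀ i₀ I → (i₀ ∷ I) ⊆ (true ∷ X) → Independent Cocircuit (i₀ ∷ I) → ∣ i₀ ∷ I ∣ ≤ r) →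
                      ∀ I → I ⊆ (true ∷ X) → Independent Cocircuit I → ∣ I ∣ ≤ r
  independent-bound X r bound (i₀ ∷ I) = bound i₀ I

  module _ (X : ES) (k : ℕ) (ncX : NC X k) where
    private
      module SX = SpanningForestOf (spanning-forest X)

      ∣F∣≡n∸k : ∣ SX.F ∣ ≡ nV G ∸ k
      ∣F∣≡n∸k = trans (sym (NP.m+n∸n≡m ∣ SX.F ∣ k))
                     (cong (_∸ k) (NP.≤-antisym (proj₂ (forest-count SX.F k ncF) SX.forest) (proj₁ (forest-count SX.F k ncF))))
        where
        ncF : NC SX.F k
        ncF = NC-cong (λ u v → conn-lift SX.conn) (λ u v → conn-mono SX.sub) ncX

      F⊆X : ∀ b → (b ∷ SX.F) ⊆ (true ∷ X)
      F⊆X b = Mem⇒⊆ λ { zero _ → refl ; (suc z) h → SX.sub z h }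

      ∣I∣≤n∸k : ∀ I → (false ∷ I) ⊆ (true ∷ X) → Independent Cocircuit (false ∷ I) → ∣ I ∣ ≤ nV G ∸ k
      ∣I∣≤n∸k I I⊆X (B , isBasis , I⊆B) = NP.m+n≤o⇒m≤o∸n ∣ I ∣ (IndependentBound.∣I∣+k≤n X k ncX B isBasis false I I⊆X I⊆B)

    rank-cobalanced : Cobalanced G L X → IsRank Cocircuit (true ∷ X) (nV G ∸ k)
    rank-cobalanced cob = (false ∷ SX.F , F⊆X false , (false ∷ ME.T , MF.basis-T , Mem⇒⊆ F⊆T) , ∣F∣≡n∸k) ,
                          independent-bound X _ bound
      where
      module ME = MaximalExtension (maximal-extension SX.F SX.forest)
      module MF = MaximalForestBasis ME.T ME.forest ME.mx
      F⊆T : ∀ i → Mem (false ∷ SX.F) i → Mem (false ∷ ME.T) i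
      F⊆T (suc z) h = ME.sup z h
      bound : ∀ i₀ I → (i₀ ∷ I) ⊆ (true ∷ X) → Independent Cocircuit (i₀ ∷ I) → ∣ i₀ ∷ I ∣ ≤ nV G ∸ k
      bound false I I⊆X ind = ∣I∣≤n∸k I I⊆X ind
      bound true I I⊆X (B , isBasis , I⊆B) = NP.m+n≤o⇒m≤o∸n (suc ∣ I ∣)
        (NP.≤-trans (NP.≤-reflexive (sym (NP.+-suc ∣ I ∣ k))) (IndependentBound.∣I∣+1+k≤n X k ncX B isBasis true I I⊆X I⊆B refl cob))

    rank-uncobalanced : ¬ Cobalanced G L X → IsRank Cocircuit (true ∷ X) (suc (nV G ∸ k))
    rank-uncobalanced ¬cob = (true ∷ SX.F , F⊆X true , (true ∷ U.S0 , U.basis , Mem⇒⊆ F⊆S₀) , cong suc ∣F∣≡n∸k) ,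
                             independent-bound X _ bound
      where
      witness = uncobalanced⇒bond X ¬cob
      B₀ = proj₁ witness
      B₀∩F=∅ : ∀ z → Mem SX.F z → lookup B₀ z ≡ false
      B₀∩F=∅ z h with lookup B₀ z in eq
      ... | false = refl
      ... | true = ⊥-elim (proj₂ (proj₂ (proj₂ witness)) z (Mem⇒∈ eq) (edge⇒conn z (SX.sub z h)))
      module U = BasisWithE₀ (basis-with-e₀ SX.F SX.forest B₀ (proj₁ (proj₂ witness)) (proj₁ (proj₂ (proj₂ witness))) B₀∩F=∅)
      F⊆S₀ : ∀ i → Mem (true ∷ SX.F) i → Mem (true ∷ U.S0) i
      F⊆S₀ zero _ = refl
      F⊆S₀ (suc z) h = U.Fsub z h
      bound : ∀ i₀ I → (i₀ ∷ I) ⊆ (true ∷ X) → Independent Cocircuit (i₀ ∷ I) → ∣ i₀ ∷ I ∣ ≤ suc (nV G ∸ k)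
      bound false I I⊆X ind = NP.m≤n⇒m≤1+n (∣I∣≤n∸k I I⊆X ind)
      bound true I I⊆X (B , isBasis , I⊆B) =
        s≤s (NP.m+n≤o⇒m≤o∸n ∣ I ∣ (IndependentBound.∣I∣+k≤n X k ncX B isBasis true I I⊆X I⊆B))

  rank-e₀ : NonTrivial G L → IsRank Cocircuit (true ∷ ∅) 1
  rank-e₀ (B₀ , isBond , LB₀) = (true ∷ ∅ , (λ h → h) , (true ∷ U.S0 , U.basis , Mem⇒⊆ e₀⊆S₀) , ∣e₀∣≡1) , bound
    where
    ∅-empty : ∀ z → Mem ∅ z → ⊥₀
    ∅-empty z h = false≢true (trans (sym (lookup-∅ z)) h)
    module U = BasisWithE₀ (basis-with-e₀ ∅ forest-∅ B₀ isBond LB₀ (λ z h → ⊥-elim (∅-empty z h)))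
    ∣e₀∣≡1 : ∣ true ∷ ∅ {nE G} ∣ ≡ 1
    ∣e₀∣≡1 = cong suc (∣⊥∣≡0 (nE G))
    e₀⊆S₀ : ∀ i → Mem (true ∷ ∅) i → Mem (true ∷ U.S0) i
    e₀⊆S₀ zero _ = refl
    e₀⊆S₀ (suc z) h = ⊥-elim (∅-empty z h)
    bound : ∀ I → I ⊆ (true ∷ ∅) → Independent Cocircuit I → ∣ I ∣ ≤ 1
    bound I I⊆e₀ _ = NP.≤-trans (p⊆q⇒∣p∣≤∣q∣ I⊆e₀) (NP.≤-reflexive ∣e₀∣≡1)

theorem3p8 : (G : Graph) (L : ESet G → Bool) → IsLinearClass G L → NonTrivial G L →
    (X : ESet G) (k : ℕ) → NumComponents G X k →
    (Cobalanced G L X → IsRankJ G L X (nV G ∸ k ∸ 1))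
    × (¬ Cobalanced G L X → IsRankJ G L X (nV G ∸ k))
theorem3p8 G L _ nonTrivial X k ncX =
  (λ cob → _ , _ , rank-cobalanced X k ncX cob , rank-e₀ nonTrivial , refl) ,
  (λ ¬cob → _ , _ , rank-uncobalanced X k ncX ¬cob , rank-e₀ nonTrivial , refl)
  where open Rank G L
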